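{- Let $f_s$ ($s\in\mathbb{P}^1\mathbb{Q}$) be defined inductively by $f_0=X$, $f_\infty=Y$, $f_{ -1}=Z$ and $$f_s=f_{s_0}f_{s_1}\,\frac{X^2+Y^2+Z^2}{XYZ}-f_{s'}$$ whenever $s_0s_1s$ and $s_0s_1s'$ are the two distinct Farey triangles containing the Farey edge $s_0s_1$. Then each $f_s$ is a Laurent polynomial in $X,Y,Z$. Moreover there is a finitely supported function $F_s:\mathbb{Z}^2\to\mathbb{Z}$ such that $$f_s=\sum_{\alpha,\beta\in\mathbb{Z}}F_s(\alpha,\beta)\,\frac{X^{1+\alpha}Y^{1+\beta}}{Z^{1+\alpha+\beta}}\ \in\ f_{[s]}\cdot\mathbb{Z}[X^{\pm2},Y^{\pm2},Z^{\pm2}].$$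
   Context: Two elements $q_0/p_0$, $q_1/p_1$ of $\mathbb{P}^1\mathbb{Q}$ (coprime integer representatives, $\infty=\pm1/0$) are Farey neighbours if $|p_0q_1-p_1q_0|=1$; a Farey edge is a pair of Farey neighbours, and a Farey triangle is a triple of pairwise Farey neighbours, equivalently $\left(\frac{q_0}{p_0},\frac{q_0+q_1}{p_0+p_1},\frac{q_1}{p_1}\right)$ with $p_0q_1-p_1q_0=\pm1$. Each Farey edge lies in exactly two Farey triangles, and since the graph dual to the Farey triangulation is a tree, the recursion consistently defines $f_s$ for all $s\in\mathbb{P}^1\mathbb{Q}$. For $s\in\mathbb{P}^1\mathbb{Q}$, $[s]$ denotes the unique element of $\{0,-1,\infty\}$ with the same image as $s$ in $\mathbb{P}^1(\mathbb{Z}/2\mathbb{Z})$; thus $f_{[s]}\in\{X,Y,Z\}$. -}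

module Defs where

open import Data.Integer as ℤ using (ℤ; +_; -[1+_]; ∣_∣)
open import Data.Integer.Divisibility as ℤD using ()
open import Data.Rational as ℚ using (ℚ; ↥_; ↧_; 0ℚ; 1ℚ)
open import Data.Nat as ℕ using (ℕ)
open import Data.Nat.DivMod using (_%_)
open import Data.List using (List; []; _∷_; map; concatMap; _++_)
open import Data.List.Relation.Unary.All using (All)
open import Data.Product using (Σ; _×_; _,_)
open import Data.Bool using (Bool; true; false; if_then_else_; _∧_)
open import Relation.Nullary using (¬_)
open import Relation.Nullary.Decidable using (⌊_⌋)
open import Relation.Binary.PropositionalEquality using (_≡_)

-- The projective line over ℚ: ∞ = 1/0, and finite points fin r.
-- (ℚ in the stdlib is normalised, so _≡_ on P1Q is equality in P¹ℚ.)

data P1Q : Set where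
  ∞   : P1Q
  fin : ℚ → P1Q

numer : P1Q → ℤ
numer ∞       = + 1
numer (fin r) = ↥ r

denom : P1Q → ℤ
denom ∞       = + 0
denom (fin r) = ↧ r

FareyNb : P1Q → P1Q → Set
FareyNb s t = ∣ denom s ℤ.* numer t ℤ.- denom t ℤ.* numer s ∣ ≡ 1

p0 p-1 : P1Q
p0  = fin 0ℚ
p-1 = fin (ℚ.- 1ℚ)

-- [s] : the element of {0, -1, ∞} with the same image in P¹(𝔽₂)
bracket : P1Q → P1Q
bracket s with ∣ numer s ∣ % 2 | ∣ denom s ∣ % 2
... | 0 | _ = p0
... | _ | 0 = ∞
... | _ | _ = p-1

-- Laurent polynomials ℤ[X^{±1}, Y^{±1}, Z^{±1}] as formal finite sums of
-- terms  c · X^a Y^b Z^e , with equality = equality of all coefficients.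

record Term : Set where
  constructor term
  field
    coef ex ey ez : ℤ

LP : Set
LP = List Term

eqᵇ : ℤ → ℤ → Bool
eqᵇ a b = ⌊ a ℤ.≟ b ⌋

coeff : LP → ℤ → ℤ → ℤ → ℤ
coeff [] a b e = + 0
coeff (term c x y z ∷ p) a b e =
  (if eqᵇ x a ∧ eqᵇ y b ∧ eqᵇ z e then c else + 0) ℤ.+ coeff p a b e

infix 4 _≈_
_≈_ : LP → LP → Set
p ≈ q = ∀ a b e → coeff p a b e ≡ coeff q a b e

mulT : Term → Term → Term
mulT (term c x y z) (term c' x' y' z') =
  term (c ℤ.* c') (x ℤ.+ x') (y ℤ.+ y') (z ℤ.+ z')

infixl 7 _*L_
_*L_ : LP → LP → LP
p *L q = concatMap (λ t → map (mulT t) q) p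

negT : Term → Term
negT (term c x y z) = term (ℤ.- c) x y z

infixl 6 _-L_
_-L_ : LP → LP → LP
p -L q = p ++ map negT q

X Y Z : LP
X = term (+ 1) (+ 1) (+ 0) (+ 0) ∷ []
Y = term (+ 1) (+ 0) (+ 1) (+ 0) ∷ []
Z = term (+ 1) (+ 0) (+ 0) (+ 1) ∷ []

-- (X² + Y² + Z²) / (XYZ) = X Y⁻¹ Z⁻¹ + X⁻¹ Y Z⁻¹ + X⁻¹ Y⁻¹ Z
K : LP
K = term (+ 1) (+ 1) -[1+ 0 ] -[1+ 0 ]
  ∷ term (+ 1) -[1+ 0 ] (+ 1) -[1+ 0 ]
  ∷ term (+ 1) -[1+ 0 ] -[1+ 0 ] (+ 1)
  ∷ []

IsMarkovFamily : (P1Q → LP) → Set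
IsMarkovFamily f =
  (f p0 ≈ X) × (f ∞ ≈ Y) × (f p-1 ≈ Z) ×
  (∀ s₀ s₁ s s' → FareyNb s₀ s₁ →
     FareyNb s₀ s → FareyNb s₁ s →
     FareyNb s₀ s' → FareyNb s₁ s' →
     ¬ (s ≡ s') →
     f s ≈ f s₀ *L f s₁ *L K -L f s')

-- Finitely supported functions F : ℤ² → ℤ, as formal finite sums of
-- entries (c, α, β) meaning  F = Σ c·δ_{(α,β)}.

FinSupp : Set
FinSupp = List (ℤ × ℤ × ℤ)

sumF : FinSupp → LP
sumF = map (λ { (c , α , β) →
  term c (+ 1 ℤ.+ α) (+ 1 ℤ.+ β) (ℤ.- (+ 1 ℤ.+ α ℤ.+ β)) })

EvenT : Term → Set
EvenT (term c x y z) = (+ 2 ℤD.∣ x) × (+ 2 ℤD.∣ y) × (+ 2 ℤD.∣ z)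

InEvenSubring : LP → Set
InEvenSubring g = All EvenT g

-- Points of P¹ℚ are primitive vectors of ℤ² up to sign, and Farey neighbours are unimodular
-- pairs.  The positive definite form Q (q , p) = q² + qp + p² equals 1 exactly at ±(0,1), ±(1,0),
-- ±(1,-1), i.e. at 0, ∞, -1.  The two apexes over a Farey edge {a, b} are ±(a ⊕ b) and ±(a ⊖ b), and
-- Q (a ± b) = Q a + Q b ± B a b with B the polar form of Q, which is odd on unimodular pairs.  So
-- exactly one apex is born on the edge, and every other primitive vector v is born on a unique edge,
-- whose vertices and opposite apex have smaller Q; its parent is the unimodular partner a of v in the
-- window 0 < B a v < 2 Q v, found by division with remainder.  Descending Q defines f on vectors,
-- independently of all choices and of the sign, the exchange relation holds along every edge, and the
-- same descent shows that every family satisfying the recursion agrees with it.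
--
-- Along the descent every term X^x Y^y Z^z of f_v has x + y + z = 1 and exponents congruent mod 2 to
-- those of f_[v]: the vertices of a Farey triangle reduce to the three distinct points of P¹𝔽₂, and
-- all exponents of K are odd.

module Submission where

open import Defs
open import Data.Bool using (Bool; true; false; _∧_; _xor_; if_then_else_)
open import Data.Bool.Properties using (xor-same)
open import Data.Integer as ℤ using (ℤ; +_; -[1+_]; +[1+_]; _+_; _*_; -_; _-_; ∣_∣; _≤_; _<_; +≤+; +<+; -≤-)
import Data.Integer.Properties as ℤP
import Data.Integer.Divisibility as ℤD
import Data.Integer.Divisibility.Signed as ℤDS
open import Data.Integer.DivMod using (_%ℕ_; _/ℕ_; n%ℕd<d; a≡a%ℕn+[a/ℕn]*n; n%d<d; a≡a%n+[a/n]*n)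
open import Data.Integer.Tactic.RingSolver using (solve-∀)
open import Data.List using (List; []; _∷_; map; _++_)
import Data.List.Properties as ListP
open import Data.List.Relation.Unary.All as All using (All; []; _∷_)
import Data.List.Relation.Unary.All.Properties as AllP
open import Data.Nat as ℕ using (ℕ; zero; suc)
import Data.Nat.Properties as ℕP
open import Data.Nat.Coprimality using (Coprime; coprime-Bézout; recompute)
open import Data.Nat.DivMod using (_%_; m%n<n)
open import Data.Nat.Divisibility using (∣1⇒≡1) renaming (_∣_ to _∣ℕ_)
open import Data.Nat.GCD using (module Bézout)
open import Data.Product using (Σ; _×_; _,_; proj₁; proj₂; map₂)
open import Data.Rational using (mkℚ)
import Data.Rational.Properties as ℚP
open import Data.Sum as Sum using (_⊎_; inj₁; inj₂)
open import Function using (_$_; _∘_; id)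
open import Level using (0ℓ)
open import Relation.Binary.Bundles using (Setoid)
open import Relation.Binary.Definitions using (Tri; tri<; tri≈; tri>)
open import Relation.Binary.PropositionalEquality
open import Relation.Nullary using (¬_; Dec; yes; no; contradiction)

-- Laurent polynomials

sumOver : {A : Set} → List A → (A → ℤ) → ℤ
sumOver []       f = + 0
sumOver (x ∷ xs) f = f x + sumOver xs f

module _ {A : Set} where

  sumOver-cong : ∀ xs {f g : A → ℤ} → (∀ x → f x ≡ g x) → sumOver xs f ≡ sumOver xs g
  sumOver-cong []       f≡g = refl
  sumOver-cong (x ∷ xs) f≡g = cong₂ _+_ (f≡g x) (sumOver-cong xs f≡g)

  sumOver-++ : ∀ xs ys (f : A → ℤ) → sumOver (xs ++ ys) f ≡ sumOver xs f + sumOver ys f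
  sumOver-++ []       ys f = sym (ℤP.+-identityˡ _)
  sumOver-++ (x ∷ xs) ys f = trans (cong (_+_ (f x)) (sumOver-++ xs ys f)) (sym (ℤP.+-assoc (f x) _ _))

  sumOver-+ : ∀ xs (f g : A → ℤ) → sumOver xs (λ x → f x + g x) ≡ sumOver xs f + sumOver xs g
  sumOver-+ []       f g = refl
  sumOver-+ (x ∷ xs) f g = trans (cong (_+_ (f x + g x)) (sumOver-+ xs f g)) (interchange (f x) (g x) _ _)
    where
    interchange : ∀ a b c d → a + b + (c + d) ≡ a + c + (b + d)
    interchange = solve-∀

  sumOver-*ˡ : ∀ xs c (f : A → ℤ) → sumOver xs (λ x → c * f x) ≡ c * sumOver xs f
  sumOver-*ˡ []       c f = sym (ℤP.*-zeroʳ c)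
  sumOver-*ˡ (x ∷ xs) c f = trans (cong (_+_ (c * f x)) (sumOver-*ˡ xs c f)) (sym (ℤP.*-distribˡ-+ c (f x) _))

  sumOver-zero : ∀ xs → sumOver xs (λ (_ : A) → + 0) ≡ + 0
  sumOver-zero []       = refl
  sumOver-zero (x ∷ xs) = trans (ℤP.+-identityˡ _) (sumOver-zero xs)

sumOver-swap : {A B : Set} (xs : List A) (ys : List B) (f : A → B → ℤ) →
               sumOver xs (λ x → sumOver ys (f x)) ≡ sumOver ys (λ y → sumOver xs (λ x → f x y))
sumOver-swap []       ys f = sym (sumOver-zero ys)
sumOver-swap (x ∷ xs) ys f =
  trans (cong (_+_ (sumOver ys (f x))) (sumOver-swap xs ys f)) (sym (sumOver-+ ys (f x) _))

coeffT : Term → ℤ → ℤ → ℤ → ℤ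
coeffT (term c x y z) a b e = if eqᵇ x a ∧ eqᵇ y b ∧ eqᵇ z e then c else + 0

eqᵇ-+ : ∀ x x′ a → eqᵇ (x + x′) a ≡ eqᵇ x′ (a - x)
eqᵇ-+ x x′ a with (x + x′) ℤ.≟ a | x′ ℤ.≟ (a - x)
... | yes _  | yes _  = refl
... | no _   | no _   = refl
... | yes eq | no neq = contradiction (trans (sym (cancelˡ x x′)) (cong (_- x) eq)) neq
  where
  cancelˡ : ∀ x x′ → x + x′ - x ≡ x′
  cancelˡ = solve-∀
... | no neq | yes eq = contradiction (trans (cong (_+_ x) eq) (cancelʳ x a)) neq
  where
  cancelʳ : ∀ x a → x + (a - x) ≡ a
  cancelʳ = solve-∀

coeffT-mulT : ∀ t u a b e → coeffT (mulT t u) a b e ≡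
              Term.coef t * coeffT u (a - Term.ex t) (b - Term.ey t) (e - Term.ez t)
coeffT-mulT (term c x y z) (term c′ x′ y′ z′) a b e
  rewrite eqᵇ-+ x x′ a | eqᵇ-+ y y′ b | eqᵇ-+ z z′ e = if-* (eqᵇ x′ (a - x) ∧ eqᵇ y′ (b - y) ∧ eqᵇ z′ (e - z))
  where
  if-* : ∀ β → (if β then c * c′ else + 0) ≡ c * (if β then c′ else + 0)
  if-* true  = refl
  if-* false = sym (ℤP.*-zeroʳ c)

coeffT-mulT-comm : ∀ t u a b e → coeffT (mulT t u) a b e ≡ coeffT (mulT u t) a b e
coeffT-mulT-comm (term c x y z) (term c′ x′ y′ z′) a b e
  rewrite ℤP.*-comm c c′ | ℤP.+-comm x x′ | ℤP.+-comm y y′ | ℤP.+-comm z z′ = refl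

coeff-sumOver : ∀ p a b e → coeff p a b e ≡ sumOver p (λ t → coeffT t a b e)
coeff-sumOver []      a b e = refl
coeff-sumOver (t ∷ p) a b e = cong (_+_ (coeffT t a b e)) (coeff-sumOver p a b e)

coeff-++ : ∀ p q a b e → coeff (p ++ q) a b e ≡ coeff p a b e + coeff q a b e
coeff-++ p q a b e = begin
  coeff (p ++ q) a b e                          ≡⟨ coeff-sumOver (p ++ q) a b e ⟩
  sumOver (p ++ q) (λ t → coeffT t a b e)       ≡⟨ sumOver-++ p q _ ⟩
  sumOver p _ + sumOver q _                     ≡⟨ sym (cong₂ _+_ (coeff-sumOver p a b e) (coeff-sumOver q a b e)) ⟩
  coeff p a b e + coeff q a b e                 ∎
  where open ≡-Reasoning

coeff-map-negT : ∀ q a b e → coeff (map negT q) a b e ≡ - coeff q a b e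
coeff-map-negT []                 a b e = refl
coeff-map-negT (term c x y z ∷ q) a b e =
  trans (cong₂ _+_ (if-neg (eqᵇ x a ∧ eqᵇ y b ∧ eqᵇ z e)) (coeff-map-negT q a b e))
        (sym (ℤP.neg-distrib-+ (coeffT (term c x y z) a b e) (coeff q a b e)))
  where
  if-neg : ∀ β → (if β then - c else + 0) ≡ - (if β then c else + 0)
  if-neg true  = refl
  if-neg false = refl

coeff--L : ∀ p q a b e → coeff (p -L q) a b e ≡ coeff p a b e - coeff q a b e
coeff--L p q a b e = trans (coeff-++ p (map negT q) a b e) (cong (_+_ (coeff p a b e)) (coeff-map-negT q a b e))

coeff-*L : ∀ p q a b e → coeff (p *L q) a b e ≡ sumOver p (λ t → sumOver q (λ u → coeffT (mulT t u) a b e))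
coeff-*L []      q a b e = refl
coeff-*L (t ∷ p) q a b e = begin
  coeff (map (mulT t) q ++ p *L q) a b e                       ≡⟨ coeff-++ (map (mulT t) q) (p *L q) a b e ⟩
  coeff (map (mulT t) q) a b e + coeff (p *L q) a b e
    ≡⟨ cong₂ _+_ (coeff-sumOver (map (mulT t) q) a b e) (coeff-*L p q a b e) ⟩
  sumOver (map (mulT t) q) (λ u → coeffT u a b e) + _          ≡⟨ cong (_+ _) (sumOver-map q) ⟩
  sumOver q (λ u → coeffT (mulT t u) a b e) + _                ∎
  where
  open ≡-Reasoning
  sumOver-map : ∀ us → sumOver (map (mulT t) us) (λ u → coeffT u a b e) ≡ sumOver us (λ u → coeffT (mulT t u) a b e)
  sumOver-map []       = refl
  sumOver-map (u ∷ us) = cong (_+_ (coeffT (mulT t u) a b e)) (sumOver-map us)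

-- Defs' _≈_ as a record type, so that both polynomials can be inferred from a proof.
infix 4 _≋_
record _≋_ (p q : LP) : Set where
  constructor coeffwise
  field coeff-≡ : p ≈ q

≋-setoid : Setoid 0ℓ 0ℓ
≋-setoid = record
  { Carrier       = LP
  ; _≈_           = _≋_
  ; isEquivalence = record
    { refl  = coeffwise λ _ _ _ → refl
    ; sym   = λ (coeffwise p≈q) → coeffwise λ a b e → sym (p≈q a b e)
    ; trans = λ (coeffwise p≈q) (coeffwise q≈r) → coeffwise λ a b e → trans (p≈q a b e) (q≈r a b e)
    }
  }

open Setoid ≋-setoid using () renaming (refl to ≋-refl; sym to ≋-sym; trans to ≋-trans)

≡⇒≋ : ∀ {p q} → p ≡ q → p ≋ q
≡⇒≋ refl = ≋-refl

*L-comm : ∀ p q → p *L q ≋ q *L p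
*L-comm p q = coeffwise λ a b e → begin
  coeff (p *L q) a b e                                             ≡⟨ coeff-*L p q a b e ⟩
  sumOver p (λ t → sumOver q (λ u → coeffT (mulT t u) a b e))      ≡⟨ sumOver-swap p q _ ⟩
  sumOver q (λ u → sumOver p (λ t → coeffT (mulT t u) a b e))
    ≡⟨ sumOver-cong q (λ u → sumOver-cong p (λ t → coeffT-mulT-comm t u a b e)) ⟩
  sumOver q (λ u → sumOver p (λ t → coeffT (mulT u t) a b e))      ≡⟨ sym (coeff-*L q p a b e) ⟩
  coeff (q *L p) a b e                                             ∎
  where open ≡-Reasoning

*L-congʳ : ∀ p {q q′} → q ≋ q′ → p *L q ≋ p *L q′
*L-congʳ p {q} {q′} (coeffwise q≈q′) = coeffwise λ a b e → begin
  coeff (p *L q) a b e                                                          ≡⟨ coeff-*L p q a b e ⟩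
  sumOver p (λ t → sumOver q (λ u → coeffT (mulT t u) a b e))
    ≡⟨ sumOver-cong p (λ t → shifted t q a b e) ⟩
  sumOver p (λ t → Term.coef t * coeff q (a - Term.ex t) (b - Term.ey t) (e - Term.ez t))
    ≡⟨ sumOver-cong p (λ t → cong (Term.coef t *_) (q≈q′ _ _ _)) ⟩
  sumOver p (λ t → Term.coef t * coeff q′ (a - Term.ex t) (b - Term.ey t) (e - Term.ez t))
    ≡⟨ sym (sumOver-cong p (λ t → shifted t q′ a b e)) ⟩
  sumOver p (λ t → sumOver q′ (λ u → coeffT (mulT t u) a b e))                  ≡⟨ sym (coeff-*L p q′ a b e) ⟩
  coeff (p *L q′) a b e                                                         ∎
  where
  open ≡-Reasoning
  shifted : ∀ t r a b e → sumOver r (λ u → coeffT (mulT t u) a b e) ≡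
            Term.coef t * coeff r (a - Term.ex t) (b - Term.ey t) (e - Term.ez t)
  shifted t r a b e = begin
    sumOver r (λ u → coeffT (mulT t u) a b e)          ≡⟨ sumOver-cong r (λ u → coeffT-mulT t u a b e) ⟩
    sumOver r (λ u → Term.coef t * coeffT u _ _ _)     ≡⟨ sumOver-*ˡ r (Term.coef t) _ ⟩
    Term.coef t * sumOver r (λ u → coeffT u _ _ _)     ≡⟨ sym (cong (Term.coef t *_) (coeff-sumOver r _ _ _)) ⟩
    Term.coef t * coeff r _ _ _                        ∎

*L-cong : ∀ {p p′ q q′} → p ≋ p′ → q ≋ q′ → p *L q ≋ p′ *L q′
*L-cong {p} {p′} {q} {q′} p≋p′ q≋q′ = begin
  p *L q    ≈⟨ *L-congʳ p q≋q′ ⟩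
  p *L q′   ≈⟨ *L-comm p q′ ⟩
  q′ *L p   ≈⟨ *L-congʳ q′ p≋p′ ⟩
  q′ *L p′  ≈⟨ *L-comm q′ p′ ⟩
  p′ *L q′  ∎
  where open import Relation.Binary.Reasoning.Setoid ≋-setoid

-L-cong : ∀ {p p′ q q′} → p ≋ p′ → q ≋ q′ → p -L q ≋ p′ -L q′
-L-cong {p} {p′} {q} {q′} (coeffwise p≈p′) (coeffwise q≈q′) = coeffwise λ a b e →
  trans (coeff--L p q a b e) (trans (cong₂ _-_ (p≈p′ a b e) (q≈q′ a b e)) (sym (coeff--L p′ q′ a b e)))

exchange : LP → LP → LP → LP
exchange p q r = p *L q *L K -L r

exchange-cong : ∀ {p p′ q q′ r r′} → p ≋ p′ → q ≋ q′ → r ≋ r′ → exchange p q r ≋ exchange p′ q′ r′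
exchange-cong p≋p′ q≋q′ r≋r′ = -L-cong (*L-cong (*L-cong p≋p′ q≋q′) ≋-refl) r≋r′

exchange-comm : ∀ p q r → exchange p q r ≋ exchange q p r
exchange-comm p q r = -L-cong (*L-cong (*L-comm p q) ≋-refl) ≋-refl

exchange-flip : ∀ {p q r s} → s ≋ exchange p q r → r ≋ exchange p q s
exchange-flip {p} {q} {r} {s} (coeffwise s≈) = coeffwise λ a b e → begin
  coeff r a b e                                         ≡⟨ sym (sub-sub (coeff (p *L q *L K) a b e) (coeff r a b e)) ⟩
  coeff (p *L q *L K) a b e - (coeff (p *L q *L K) a b e - coeff r a b e)
    ≡⟨ cong (_-_ (coeff (p *L q *L K) a b e)) (sym (trans (s≈ a b e) (coeff--L (p *L q *L K) r a b e))) ⟩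
  coeff (p *L q *L K) a b e - coeff s a b e             ≡⟨ sym (coeff--L (p *L q *L K) s a b e) ⟩
  coeff (exchange p q s) a b e                          ∎
  where
  open ≡-Reasoning
  sub-sub : ∀ x y → x - (x - y) ≡ y
  sub-sub = solve-∀

-- Parity

bit : Bool → ℤ
bit false = + 0
bit true  = + 1

isOdd : ℤ → Bool
isOdd x = x %ℕ 2 ℕ.≡ᵇ 1

isOdd-decomposition : ∀ x → x ≡ bit (isOdd x) + + 2 * (x /ℕ 2)
isOdd-decomposition x = trans (a≡a%ℕn+[a/ℕn]*n x 2)
  (cong₂ _+_ (remainder (x %ℕ 2) (n%ℕd<d x 2)) (ℤP.*-comm (x /ℕ 2) (+ 2)))
  where
  remainder : ∀ r → r ℕ.< 2 → + r ≡ bit (r ℕ.≡ᵇ 1)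
  remainder 0 _ = refl
  remainder 1 _ = refl
  remainder (suc (suc r)) (ℕ.s≤s (ℕ.s≤s ()))

even≢odd : ∀ q q′ → bit false + + 2 * q ≢ bit true + + 2 * q′
even≢odd q q′ eq with ℕP.m*n≡1⇒m≡1 2 ∣ q - q′ ∣ (begin
  2 ℕ.* ∣ q - q′ ∣                        ≡⟨ sym (ℤP.abs-* (+ 2) (q - q′)) ⟩
  ∣ + 2 * (q - q′) ∣                      ≡⟨ cong ∣_∣ (trans (sym (rearrange q q′)) (cong (_- (+ 2 * q′)) eq)) ⟩
  ∣ bit true + + 2 * q′ - + 2 * q′ ∣      ≡⟨ cong ∣_∣ (cancel q′) ⟩
  1                                       ∎)
  where
  open ≡-Reasoning
  rearrange : ∀ q q′ → + 0 + + 2 * q - + 2 * q′ ≡ + 2 * (q - q′)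
  rearrange = solve-∀
  cancel : ∀ q′ → + 1 + + 2 * q′ - + 2 * q′ ≡ + 1
  cancel = solve-∀
... | ()

bit+2*-injective : ∀ r r′ q q′ → bit r + + 2 * q ≡ bit r′ + + 2 * q′ → r ≡ r′
bit+2*-injective false false q q′ eq = refl
bit+2*-injective true  true  q q′ eq = refl
bit+2*-injective false true  q q′ eq = contradiction eq (even≢odd q q′)
bit+2*-injective true  false q q′ eq = contradiction (sym eq) (even≢odd q′ q)

isOdd-+2* : ∀ {x} y k → x ≡ y + + 2 * k → isOdd x ≡ isOdd y
isOdd-+2* {x} y k eq = bit+2*-injective (isOdd x) (isOdd y) (x /ℕ 2) (y /ℕ 2 + k) (begin
  bit (isOdd x) + + 2 * (x /ℕ 2)             ≡⟨ sym (isOdd-decomposition x) ⟩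
  x                                          ≡⟨ eq ⟩
  y + + 2 * k                                ≡⟨ cong (_+ + 2 * k) (isOdd-decomposition y) ⟩
  bit (isOdd y) + + 2 * (y /ℕ 2) + + 2 * k   ≡⟨ rearrange (bit (isOdd y)) (y /ℕ 2) k ⟩
  bit (isOdd y) + + 2 * (y /ℕ 2 + k)         ∎)
  where
  open ≡-Reasoning
  rearrange : ∀ b h k → b + + 2 * h + + 2 * k ≡ b + + 2 * (h + k)
  rearrange = solve-∀

isOdd-neg : ∀ x → isOdd (- x) ≡ isOdd x
isOdd-neg x = isOdd-+2* x (- x) (double x)
  where
  double : ∀ x → - x ≡ x + + 2 * (- x)
  double = solve-∀

isOdd-+ : ∀ x y → isOdd (x + y) ≡ isOdd x xor isOdd y
isOdd-+ x y = trans (isOdd-+2* (bit r + bit s) (x /ℕ 2 + y /ℕ 2) x+y≡) (bits r s)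
  where
  r s : Bool
  r = isOdd x
  s = isOdd y
  rearrange : ∀ b c h k → b + + 2 * h + (c + + 2 * k) ≡ b + c + + 2 * (h + k)
  rearrange = solve-∀
  x+y≡ : x + y ≡ bit r + bit s + + 2 * (x /ℕ 2 + y /ℕ 2)
  x+y≡ = trans (cong₂ _+_ (isOdd-decomposition x) (isOdd-decomposition y)) (rearrange (bit r) (bit s) _ _)
  bits : ∀ r s → isOdd (bit r + bit s) ≡ r xor s
  bits false false = refl
  bits false true  = refl
  bits true  false = refl
  bits true  true  = refl

isOdd-* : ∀ x y → isOdd (x * y) ≡ isOdd x ∧ isOdd y
isOdd-* x y = trans (isOdd-+2* (bit r * bit s) (h * bit s + bit r * k + + 2 * h * k) x*y≡) (bits r s)
  where
  r s : Bool
  r = isOdd x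
  s = isOdd y
  h k : ℤ
  h = x /ℕ 2
  k = y /ℕ 2
  expand : ∀ b c h k → (b + + 2 * h) * (c + + 2 * k) ≡ b * c + + 2 * (h * c + b * k + + 2 * h * k)
  expand = solve-∀
  x*y≡ : x * y ≡ bit r * bit s + + 2 * (h * bit s + bit r * k + + 2 * h * k)
  x*y≡ = trans (cong₂ _*_ (isOdd-decomposition x) (isOdd-decomposition y)) (expand (bit r) (bit s) h k)
  bits : ∀ r s → isOdd (bit r * bit s) ≡ r ∧ s
  bits false false = refl
  bits false true  = refl
  bits true  false = refl
  bits true  true  = refl

isOdd-- : ∀ x y → isOdd (x - y) ≡ isOdd x xor isOdd y
isOdd-- x y = trans (isOdd-+ x (- y)) (cong (isOdd x xor_) (isOdd-neg y))

-- The plane ℤ² and the form Q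

V : Set
V = ℤ × ℤ

infixl 6 _⊕_ _⊖_
infixr 7 _•_
_⊕_ _⊖_ : V → V → V
(a₁ , a₂) ⊕ (b₁ , b₂) = a₁ + b₁ , a₂ + b₂
(a₁ , a₂) ⊖ (b₁ , b₂) = a₁ - b₁ , a₂ - b₂

⊝_ : V → V
⊝ (a₁ , a₂) = - a₁ , - a₂

_•_ : ℤ → V → V
k • (a₁ , a₂) = k * a₁ , k * a₂

det : V → V → ℤ
det (a₁ , a₂) (b₁ , b₂) = a₁ * b₂ - a₂ * b₁

Q : V → ℤ
Q (a₁ , a₂) = a₁ * a₁ + a₁ * a₂ + a₂ * a₂

B : V → V → ℤ
B (a₁ , a₂) (b₁ , b₂) = + 2 * (a₁ * b₁) + a₁ * b₂ + a₂ * b₁ + + 2 * (a₂ * b₂)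

⊕-comm : ∀ a b → a ⊕ b ≡ b ⊕ a
⊕-comm (a₁ , a₂) (b₁ , b₂) = cong₂ _,_ (ℤP.+-comm a₁ b₁) (ℤP.+-comm a₂ b₂)

⊕-⊖-cancel : ∀ a v → a ⊕ (v ⊖ a) ≡ v
⊕-⊖-cancel (a₁ , a₂) (v₁ , v₂) = cong₂ _,_ (identity a₁ v₁) (identity a₂ v₂)
  where
  identity : ∀ a v → a + (v - a) ≡ v
  identity = solve-∀

⊕-⊖-cancel′ : ∀ a b → (a ⊕ b) ⊖ a ≡ b
⊕-⊖-cancel′ (a₁ , a₂) (b₁ , b₂) = cong₂ _,_ (identity a₁ b₁) (identity a₂ b₂)
  where
  identity : ∀ a b → a + b - a ≡ b
  identity = solve-∀

⊝-involutive : ∀ a → ⊝ ⊝ a ≡ a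
⊝-involutive (a₁ , a₂) = cong₂ _,_ (ℤP.neg-involutive a₁) (ℤP.neg-involutive a₂)

⊝-⊕ : ∀ a b → ⊝ a ⊕ ⊝ b ≡ ⊝ (a ⊕ b)
⊝-⊕ (a₁ , a₂) (b₁ , b₂) = cong₂ _,_ (sym (ℤP.neg-distrib-+ a₁ b₁)) (sym (ℤP.neg-distrib-+ a₂ b₂))

⊝-⊖ : ∀ a b → ⊝ a ⊖ ⊝ b ≡ ⊝ (a ⊖ b)
⊝-⊖ (a₁ , a₂) (b₁ , b₂) = cong₂ _,_ (sym (ℤP.neg-distrib-+ a₁ (- b₁))) (sym (ℤP.neg-distrib-+ a₂ (- b₂)))

⊖-anticomm : ∀ a b → b ⊖ a ≡ ⊝ (a ⊖ b)
⊖-anticomm (a₁ , a₂) (b₁ , b₂) = cong₂ _,_ (identity a₁ b₁) (identity a₂ b₂)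
  where
  identity : ∀ a b → b - a ≡ - (a - b)
  identity = solve-∀

⊖-⊝ : ∀ a b → a ⊖ ⊝ b ≡ a ⊕ b
⊖-⊝ (a₁ , a₂) (b₁ , b₂) = cong₂ _,_ (cong (_+_ a₁) (ℤP.neg-involutive b₁)) (cong (_+_ a₂) (ℤP.neg-involutive b₂))

cramer : ∀ v a x → det v a • x ≡ det x a • v ⊕ det v x • a
cramer (v₁ , v₂) (a₁ , a₂) (x₁ , x₂) = cong₂ _,_ (identity₁ v₁ v₂ a₁ a₂ x₁ x₂) (identity₂ v₁ v₂ a₁ a₂ x₁ x₂)
  where
  identity₁ : ∀ v₁ v₂ a₁ a₂ x₁ x₂ →
    (v₁ * a₂ - v₂ * a₁) * x₁ ≡ (x₁ * a₂ - x₂ * a₁) * v₁ + (v₁ * x₂ - v₂ * x₁) * a₁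
  identity₁ = solve-∀
  identity₂ : ∀ v₁ v₂ a₁ a₂ x₁ x₂ →
    (v₁ * a₂ - v₂ * a₁) * x₂ ≡ (x₁ * a₂ - x₂ * a₁) * v₂ + (v₁ * x₂ - v₂ * x₁) * a₂
  identity₂ = solve-∀

parallel : ∀ v a x → det v a ≡ + 1 → det v x ≡ + 0 → x ≡ det x a • v
parallel v a x@(x₁ , x₂) det[v,a]≡1 det[v,x]≡0 = begin
  x                                      ≡⟨ cong₂ _,_ (sym (ℤP.*-identityˡ x₁)) (sym (ℤP.*-identityˡ x₂)) ⟩
  + 1 • x                                ≡⟨ cong (_• x) (sym det[v,a]≡1) ⟩
  det v a • x                            ≡⟨ cramer v a x ⟩
  det x a • v ⊕ det v x • a              ≡⟨ cong (λ d → det x a • v ⊕ d • a) det[v,x]≡0 ⟩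
  det x a • v ⊕ + 0 • a                  ≡⟨ cong₂ _,_ (ℤP.+-identityʳ _) (ℤP.+-identityʳ _) ⟩
  det x a • v                            ∎
  where open ≡-Reasoning

det-self : ∀ a → det a a ≡ + 0
det-self (a₁ , a₂) = identity a₁ a₂
  where
  identity : ∀ a₁ a₂ → a₁ * a₂ - a₂ * a₁ ≡ + 0
  identity = solve-∀

det-antisym : ∀ a b → det a b ≡ - det b a
det-antisym (a₁ , a₂) (b₁ , b₂) = identity a₁ a₂ b₁ b₂
  where
  identity : ∀ a₁ a₂ b₁ b₂ → a₁ * b₂ - a₂ * b₁ ≡ - (b₁ * a₂ - b₂ * a₁)
  identity = solve-∀

det-⊝ʳ : ∀ a b → det a (⊝ b) ≡ - det a b
det-⊝ʳ (a₁ , a₂) (b₁ , b₂) = identity a₁ a₂ b₁ b₂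
  where
  identity : ∀ a₁ a₂ b₁ b₂ → a₁ * - b₂ - a₂ * - b₁ ≡ - (a₁ * b₂ - a₂ * b₁)
  identity = solve-∀

det-⊝ : ∀ a b → det (⊝ a) (⊝ b) ≡ det a b
det-⊝ (a₁ , a₂) (b₁ , b₂) = identity a₁ a₂ b₁ b₂
  where
  identity : ∀ a₁ a₂ b₁ b₂ → - a₁ * - b₂ - - a₂ * - b₁ ≡ a₁ * b₂ - a₂ * b₁
  identity = solve-∀

det-⊕ʳ-self : ∀ a b → det a (a ⊕ b) ≡ det a b
det-⊕ʳ-self (a₁ , a₂) (b₁ , b₂) = identity a₁ a₂ b₁ b₂
  where
  identity : ∀ a₁ a₂ b₁ b₂ → a₁ * (a₂ + b₂) - a₂ * (a₁ + b₁) ≡ a₁ * b₂ - a₂ * b₁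
  identity = solve-∀

det-⊕ˡ-self : ∀ a b → det (a ⊕ b) a ≡ det b a
det-⊕ˡ-self (a₁ , a₂) (b₁ , b₂) = identity a₁ a₂ b₁ b₂
  where
  identity : ∀ a₁ a₂ b₁ b₂ → (a₁ + b₁) * a₂ - (a₂ + b₂) * a₁ ≡ b₁ * a₂ - b₂ * a₁
  identity = solve-∀

det-⊖ʳ-self : ∀ a b → det a (a ⊖ b) ≡ - det a b
det-⊖ʳ-self (a₁ , a₂) (b₁ , b₂) = identity a₁ a₂ b₁ b₂
  where
  identity : ∀ a₁ a₂ b₁ b₂ → a₁ * (a₂ - b₂) - a₂ * (a₁ - b₁) ≡ - (a₁ * b₂ - a₂ * b₁)
  identity = solve-∀

det-⊖ˡ-self : ∀ v a → det (v ⊖ a) a ≡ det v a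
det-⊖ˡ-self (v₁ , v₂) (a₁ , a₂) = identity v₁ v₂ a₁ a₂
  where
  identity : ∀ v₁ v₂ a₁ a₂ → (v₁ - a₁) * a₂ - (v₂ - a₂) * a₁ ≡ v₁ * a₂ - v₂ * a₁
  identity = solve-∀

det-⊖ʳ : ∀ v x y → det v (x ⊖ y) ≡ det v x - det v y
det-⊖ʳ (v₁ , v₂) (x₁ , x₂) (y₁ , y₂) = identity v₁ v₂ x₁ x₂ y₁ y₂
  where
  identity : ∀ v₁ v₂ x₁ x₂ y₁ y₂ → v₁ * (x₂ - y₂) - v₂ * (x₁ - y₁) ≡ v₁ * x₂ - v₂ * x₁ - (v₁ * y₂ - v₂ * y₁)
  identity = solve-∀

det-•ʳ-self : ∀ v k → det v (k • v) ≡ + 0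
det-•ʳ-self (v₁ , v₂) k = identity v₁ v₂ k
  where
  identity : ∀ v₁ v₂ k → v₁ * (k * v₂) - v₂ * (k * v₁) ≡ + 0
  identity = solve-∀

Q-⊕ : ∀ a b → Q (a ⊕ b) ≡ Q a + Q b + B a b
Q-⊕ (a₁ , a₂) (b₁ , b₂) = identity a₁ a₂ b₁ b₂
  where
  identity : ∀ a₁ a₂ b₁ b₂ → (a₁ + b₁) * (a₁ + b₁) + (a₁ + b₁) * (a₂ + b₂) + (a₂ + b₂) * (a₂ + b₂) ≡
             a₁ * a₁ + a₁ * a₂ + a₂ * a₂ + (b₁ * b₁ + b₁ * b₂ + b₂ * b₂) +
             (+ 2 * (a₁ * b₁) + a₁ * b₂ + a₂ * b₁ + + 2 * (a₂ * b₂))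
  identity = solve-∀

Q-⊖ : ∀ a b → Q (a ⊖ b) ≡ Q a + Q b - B a b
Q-⊖ (a₁ , a₂) (b₁ , b₂) = identity a₁ a₂ b₁ b₂
  where
  identity : ∀ a₁ a₂ b₁ b₂ → (a₁ - b₁) * (a₁ - b₁) + (a₁ - b₁) * (a₂ - b₂) + (a₂ - b₂) * (a₂ - b₂) ≡
             a₁ * a₁ + a₁ * a₂ + a₂ * a₂ + (b₁ * b₁ + b₁ * b₂ + b₂ * b₂) -
             (+ 2 * (a₁ * b₁) + a₁ * b₂ + a₂ * b₁ + + 2 * (a₂ * b₂))
  identity = solve-∀

Q-⊝ : ∀ a → Q (⊝ a) ≡ Q a
Q-⊝ (a₁ , a₂) = identity a₁ a₂
  where
  identity : ∀ a₁ a₂ → - a₁ * - a₁ + - a₁ * - a₂ + - a₂ * - a₂ ≡ a₁ * a₁ + a₁ * a₂ + a₂ * a₂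
  identity = solve-∀

B-comm : ∀ a b → B a b ≡ B b a
B-comm (a₁ , a₂) (b₁ , b₂) = identity a₁ a₂ b₁ b₂
  where
  identity : ∀ a₁ a₂ b₁ b₂ → + 2 * (a₁ * b₁) + a₁ * b₂ + a₂ * b₁ + + 2 * (a₂ * b₂) ≡
             + 2 * (b₁ * a₁) + b₁ * a₂ + b₂ * a₁ + + 2 * (b₂ * a₂)
  identity = solve-∀

B-⊝ʳ : ∀ a b → B a (⊝ b) ≡ - B a b
B-⊝ʳ (a₁ , a₂) (b₁ , b₂) = identity a₁ a₂ b₁ b₂
  where
  identity : ∀ a₁ a₂ b₁ b₂ → + 2 * (a₁ * - b₁) + a₁ * - b₂ + a₂ * - b₁ + + 2 * (a₂ * - b₂) ≡
             - (+ 2 * (a₁ * b₁) + a₁ * b₂ + a₂ * b₁ + + 2 * (a₂ * b₂))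
  identity = solve-∀

B-⊝ : ∀ a b → B (⊝ a) (⊝ b) ≡ B a b
B-⊝ (a₁ , a₂) (b₁ , b₂) = identity a₁ a₂ b₁ b₂
  where
  identity : ∀ a₁ a₂ b₁ b₂ → + 2 * (- a₁ * - b₁) + - a₁ * - b₂ + - a₂ * - b₁ + + 2 * (- a₂ * - b₂) ≡
             + 2 * (a₁ * b₁) + a₁ * b₂ + a₂ * b₁ + + 2 * (a₂ * b₂)
  identity = solve-∀

B-self : ∀ v → B v v ≡ + 2 * Q v
B-self (v₁ , v₂) = identity v₁ v₂
  where
  identity : ∀ v₁ v₂ → + 2 * (v₁ * v₁) + v₁ * v₂ + v₂ * v₁ + + 2 * (v₂ * v₂) ≡ + 2 * (v₁ * v₁ + v₁ * v₂ + v₂ * v₂)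
  identity = solve-∀

B-⊕ˡ : ∀ x y v → B (x ⊕ y) v ≡ B x v + B y v
B-⊕ˡ (x₁ , x₂) (y₁ , y₂) (v₁ , v₂) = identity x₁ x₂ y₁ y₂ v₁ v₂
  where
  identity : ∀ x₁ x₂ y₁ y₂ v₁ v₂ →
    + 2 * ((x₁ + y₁) * v₁) + (x₁ + y₁) * v₂ + (x₂ + y₂) * v₁ + + 2 * ((x₂ + y₂) * v₂) ≡
    + 2 * (x₁ * v₁) + x₁ * v₂ + x₂ * v₁ + + 2 * (x₂ * v₂) + (+ 2 * (y₁ * v₁) + y₁ * v₂ + y₂ * v₁ + + 2 * (y₂ * v₂))
  identity = solve-∀

B-⊖ˡ : ∀ x y v → B (x ⊖ y) v ≡ B x v - B y v
B-⊖ˡ (x₁ , x₂) (y₁ , y₂) (v₁ , v₂) = identity x₁ x₂ y₁ y₂ v₁ v₂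
  where
  identity : ∀ x₁ x₂ y₁ y₂ v₁ v₂ →
    + 2 * ((x₁ - y₁) * v₁) + (x₁ - y₁) * v₂ + (x₂ - y₂) * v₁ + + 2 * ((x₂ - y₂) * v₂) ≡
    + 2 * (x₁ * v₁) + x₁ * v₂ + x₂ * v₁ + + 2 * (x₂ * v₂) - (+ 2 * (y₁ * v₁) + y₁ * v₂ + y₂ * v₁ + + 2 * (y₂ * v₂))
  identity = solve-∀

B-•ˡ-self : ∀ k v → B (k • v) v ≡ k * (+ 2 * Q v)
B-•ˡ-self k (v₁ , v₂) = identity k v₁ v₂
  where
  identity : ∀ k v₁ v₂ → + 2 * (k * v₁ * v₁) + k * v₁ * v₂ + k * v₂ * v₁ + + 2 * (k * v₂ * v₂) ≡
             k * (+ 2 * (v₁ * v₁ + v₁ * v₂ + v₂ * v₂))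
  identity = solve-∀

B-⊕ʳ-self : ∀ a b → B a (a ⊕ b) ≡ + 2 * Q a + B a b
B-⊕ʳ-self (a₁ , a₂) (b₁ , b₂) = identity a₁ a₂ b₁ b₂
  where
  identity : ∀ a₁ a₂ b₁ b₂ → + 2 * (a₁ * (a₁ + b₁)) + a₁ * (a₂ + b₂) + a₂ * (a₁ + b₁) + + 2 * (a₂ * (a₂ + b₂)) ≡
             + 2 * (a₁ * a₁ + a₁ * a₂ + a₂ * a₂) + (+ 2 * (a₁ * b₁) + a₁ * b₂ + a₂ * b₁ + + 2 * (a₂ * b₂))
  identity = solve-∀

B-⊖ˡ-self : ∀ v a → B (v ⊖ a) v ≡ + 2 * Q v - B a v
B-⊖ˡ-self (v₁ , v₂) (a₁ , a₂) = identity v₁ v₂ a₁ a₂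
  where
  identity : ∀ v₁ v₂ a₁ a₂ →
    + 2 * ((v₁ - a₁) * v₁) + (v₁ - a₁) * v₂ + (v₂ - a₂) * v₁ + + 2 * ((v₂ - a₂) * v₂) ≡
    + 2 * (v₁ * v₁ + v₁ * v₂ + v₂ * v₂) - (+ 2 * (a₁ * v₁) + a₁ * v₂ + a₂ * v₁ + + 2 * (a₂ * v₂))
  identity = solve-∀

B-product : ∀ v a → B a v * B (v ⊖ a) v ≡ + 2 * (B a (v ⊖ a) * Q v) + + 3 * (det v a * det v a)
B-product (v₁ , v₂) (a₁ , a₂) = identity v₁ v₂ a₁ a₂
  where
  identity : ∀ v₁ v₂ a₁ a₂ →
    (+ 2 * (a₁ * v₁) + a₁ * v₂ + a₂ * v₁ + + 2 * (a₂ * v₂)) *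
    (+ 2 * ((v₁ - a₁) * v₁) + (v₁ - a₁) * v₂ + (v₂ - a₂) * v₁ + + 2 * ((v₂ - a₂) * v₂)) ≡
    + 2 * ((+ 2 * (a₁ * (v₁ - a₁)) + a₁ * (v₂ - a₂) + a₂ * (v₁ - a₁) + + 2 * (a₂ * (v₂ - a₂))) *
           (v₁ * v₁ + v₁ * v₂ + v₂ * v₂))
    + + 3 * ((v₁ * a₂ - v₂ * a₁) * (v₁ * a₂ - v₂ * a₁))
  identity = solve-∀

key-identity : ∀ a b → + 4 * (Q a * Q b) ≡ B a b * B a b + + 3 * (det a b * det a b)
key-identity (a₁ , a₂) (b₁ , b₂) = identity a₁ a₂ b₁ b₂
  where
  identity : ∀ a₁ a₂ b₁ b₂ →
    + 4 * ((a₁ * a₁ + a₁ * a₂ + a₂ * a₂) * (b₁ * b₁ + b₁ * b₂ + b₂ * b₂)) ≡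
    (+ 2 * (a₁ * b₁) + a₁ * b₂ + a₂ * b₁ + + 2 * (a₂ * b₂)) * (+ 2 * (a₁ * b₁) + a₁ * b₂ + a₂ * b₁ + + 2 * (a₂ * b₂))
    + + 3 * ((a₁ * b₂ - a₂ * b₁) * (a₁ * b₂ - a₂ * b₁))
  identity = solve-∀

isOdd-B : ∀ a b → isOdd (B a b) ≡ isOdd (det a b)
isOdd-B (a₁ , a₂) (b₁ , b₂) = isOdd-+2* (det (a₁ , a₂) (b₁ , b₂)) (a₁ * b₁ + a₂ * b₁ + a₂ * b₂) (identity a₁ a₂ b₁ b₂)
  where
  identity : ∀ a₁ a₂ b₁ b₂ → + 2 * (a₁ * b₁) + a₁ * b₂ + a₂ * b₁ + + 2 * (a₂ * b₂) ≡
             a₁ * b₂ - a₂ * b₁ + + 2 * (a₁ * b₁ + a₂ * b₁ + a₂ * b₂)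
  identity = solve-∀

≤-by : ∀ {x y} d → y ≡ x + d → + 0 ≤ d → x ≤ y
≤-by {x} d refl 0≤d = subst (_≤ x + d) (ℤP.+-identityʳ x) (ℤP.+-monoʳ-≤ x 0≤d)

<-by : ∀ {x y} d → y ≡ x + d → + 0 < d → x < y
<-by {x} d refl 0<d = subst (_< x + d) (ℤP.+-identityʳ x) (ℤP.+-monoʳ-< x 0<d)

i<j⇒0<j-i : ∀ {i j} → i < j → + 0 < j - i
i<j⇒0<j-i {i} {j} i<j = subst (_< j - i) (ℤP.+-inverseʳ i) (ℤP.+-monoˡ-< (- i) i<j)

0≤+ : ∀ {x y} → + 0 ≤ x → + 0 ≤ y → + 0 ≤ x + y
0≤+ = ℤP.+-mono-≤

0≤* : ∀ {x y} → + 0 ≤ x → + 0 ≤ y → + 0 ≤ x * y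
0≤* {x} {y} 0≤x 0≤y = subst (_≤ x * y) (ℤP.*-zeroʳ x) (ℤP.*-monoˡ-≤-nonNeg x {{ℤ.nonNegative 0≤x}} 0≤y)

0<* : ∀ {x y} → + 0 < x → + 0 < y → + 0 < x * y
0<* {x} {y} 0<x 0<y = subst (_< x * y) (ℤP.*-zeroʳ x) (ℤP.*-monoˡ-<-pos x {{ℤ.positive 0<x}} 0<y)

0≤² : ∀ x → + 0 ≤ x * x
0≤² (+ n)    = 0≤* {+ n} {+ n} (+≤+ ℕ.z≤n) (+≤+ ℕ.z≤n)
0≤² -[1+ n ] = +≤+ ℕ.z≤n

3≰1 : ¬ (+ 3 ≤ + 1)
3≰1 (ℤ.+≤+ (ℕ.s≤s ()))

-n<k*n<n⇒k≡0 : ∀ {k n} → + 0 < n → - n < k * n → k * n < n → k ≡ + 0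
-n<k*n<n⇒k≡0 {k} {n} 0<n -n<kn kn<n = ℤP.≤-antisym k≤0 0≤k
  where
  instance
    n-nonNeg : ℤ.NonNegative n
    n-nonNeg = ℤ.nonNegative (ℤP.<⇒≤ 0<n)
  k≤0 : k ≤ + 0
  k≤0 = ℤP.i<j⇒i≤pred[j] (ℤP.*-cancelʳ-<-nonNeg {k} {+ 1} n (subst (k * n <_) (sym (ℤP.*-identityˡ n)) kn<n))
  0≤k : + 0 ≤ k
  0≤k = ℤP.i<j⇒suc[i]≤j (ℤP.*-cancelʳ-<-nonNeg { -[1+ 0 ]} {k} n (subst (_< k * n) (sym (ℤP.-1*i≡-i n)) -n<kn))

-n<y-x<n : ∀ {x y n} → + 0 < x → x < n → + 0 < y → y < n → - n < y - x × y - x < n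
-n<y-x<n 0<x x<n 0<y y<n =
  subst (_< _) (ℤP.+-identityˡ _) (ℤP.+-mono-< 0<y (ℤP.neg-mono-< x<n)) ,
  subst (_ <_) (ℤP.+-identityʳ _) (ℤP.+-mono-<-≤ y<n (ℤP.neg-mono-≤ (ℤP.<⇒≤ 0<x)))

0<2pq+3⇒0<p : ∀ {p q} → + 0 < + 2 * (p * q) + + 3 → + 2 ≤ q → p ≢ + 0 → + 0 < p
0<2pq+3⇒0<p {+[1+ n ]} _ _ _ = +<+ (ℕ.s≤s ℕ.z≤n)
0<2pq+3⇒0<p {+ zero}   _ _ p≢0 = contradiction refl p≢0
0<2pq+3⇒0<p {p@(-[1+ n ])} {q} 0<2pq+3 2≤q _ = contradiction (ℤP.<-≤-trans 0<2pq+3 2pq+3≤-1) λ ()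
  where
  open ℤP.≤-Reasoning
  instance
    q-nonNeg : ℤ.NonNegative q
    q-nonNeg = ℤ.nonNegative (ℤP.≤-trans (+≤+ ℕ.z≤n) 2≤q)
  2pq+3≤-1 : + 2 * (p * q) + + 3 ≤ -[1+ 0 ]
  2pq+3≤-1 = ℤP.+-monoˡ-≤ (+ 3) (ℤP.*-monoˡ-≤-nonNeg (+ 2) (begin
    p * q           ≤⟨ ℤP.*-monoʳ-≤-nonNeg q (-≤- {n} {0} ℕ.z≤n) ⟩
    -[1+ 0 ] * q    ≡⟨ ℤP.-1*i≡-i q ⟩
    - q             ≤⟨ ℤP.neg-mono-≤ 2≤q ⟩
    -[1+ 1 ]        ∎))

Q-nonneg : ∀ a → + 0 ≤ Q a
Q-nonneg a@(a₁ , a₂) = ℤP.*-cancelˡ-≤-pos (+ 0) (Q a) (+ 4)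
  (subst (+ 0 ≤_) (sym (identity a₁ a₂)) (0≤+ (0≤² (+ 2 * a₁ + a₂)) (0≤* {+ 3} (+≤+ ℕ.z≤n) (0≤² a₂))))
  where
  identity : ∀ a₁ a₂ → + 4 * (a₁ * a₁ + a₁ * a₂ + a₂ * a₂) ≡ (+ 2 * a₁ + a₂) * (+ 2 * a₁ + a₂) + + 3 * (a₂ * a₂)
  identity = solve-∀

record Unimodular (a b : V) : Set where
  constructor unimodular
  field ∣det∣≡1 : ∣ det a b ∣ ≡ 1

∣i∣≡1⇒i≡±1 : ∀ {d} → ∣ d ∣ ≡ 1 → d ≡ + 1 ⊎ d ≡ -[1+ 0 ]
∣i∣≡1⇒i≡±1 {+ _}           refl = inj₁ refl
∣i∣≡1⇒i≡±1 { -[1+ zero ]}  refl = inj₂ refl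

det≡1⇒unimodular : ∀ {a b} → det a b ≡ + 1 → Unimodular a b
det≡1⇒unimodular eq = unimodular (cong ∣_∣ eq)

unimodular-sym : ∀ {a b} → Unimodular a b → Unimodular b a
unimodular-sym {a} {b} (unimodular u) =
  unimodular $ trans (cong ∣_∣ (det-antisym b a)) (trans (ℤP.∣-i∣≡∣i∣ (det a b)) u)

unimodular-⊝ʳ : ∀ {a b} → Unimodular a b → Unimodular a (⊝ b)
unimodular-⊝ʳ {a} {b} (unimodular u) =
  unimodular $ trans (cong ∣_∣ (det-⊝ʳ a b)) (trans (ℤP.∣-i∣≡∣i∣ (det a b)) u)

unimodular-det² : ∀ {a b} → Unimodular a b → det a b * det a b ≡ + 1
unimodular-det² {a} {b} (unimodular u) = square (∣i∣≡1⇒i≡±1 {det a b} u)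
  where
  square : ∀ {d} → d ≡ + 1 ⊎ d ≡ -[1+ 0 ] → d * d ≡ + 1
  square (inj₁ refl) = refl
  square (inj₂ refl) = refl

unimodular-isOdd : ∀ {a b} → Unimodular a b → isOdd (det a b) ≡ true
unimodular-isOdd {a} {b} (unimodular u) = odd (∣i∣≡1⇒i≡±1 {det a b} u)
  where
  odd : ∀ {d} → d ≡ + 1 ⊎ d ≡ -[1+ 0 ] → isOdd d ≡ true
  odd (inj₁ refl) = refl
  odd (inj₂ refl) = refl

unimodular-triangle : ∀ {a b} → Unimodular a b →
  Unimodular a (a ⊕ b) × Unimodular b (a ⊕ b) × Unimodular a (a ⊖ b) × Unimodular b (a ⊖ b)
unimodular-triangle {a} {b} (unimodular u) =
  unimodular (trans (cong ∣_∣ (det-⊕ʳ-self a b)) u) ,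
  unimodular (trans (cong ∣_∣ (trans (cong (det b) (⊕-comm a b)) (det-⊕ʳ-self b a))) ∣det[b,a]∣≡1) ,
  unimodular (trans (cong ∣_∣ (det-⊖ʳ-self a b)) (trans (ℤP.∣-i∣≡∣i∣ (det a b)) u)) ,
  unimodular (trans (cong ∣_∣ det[b,a⊖b]≡det[b,a]) ∣det[b,a]∣≡1)
  where
  ∣det[b,a]∣≡1 : ∣ det b a ∣ ≡ 1
  ∣det[b,a]∣≡1 = Unimodular.∣det∣≡1 (unimodular-sym {a} {b} (unimodular u))
  det[b,a⊖b]≡det[b,a] : det b (a ⊖ b) ≡ det b a
  det[b,a⊖b]≡det[b,a] = trans (det-⊖ʳ b a b) (trans (cong (_-_ (det b a)) (det-self b)) (ℤP.+-identityʳ (det b a)))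

B≢0 : ∀ {a b} → Unimodular a b → B a b ≢ + 0
B≢0 {a} {b} u B≡0 with trans (sym (cong isOdd B≡0)) (trans (isOdd-B a b) (unimodular-isOdd u))
... | ()

Q≥1 : ∀ {a b} → Unimodular a b → + 1 ≤ Q a
Q≥1 {a} {b} u = ℤP.i<j⇒suc[i]≤j (ℤP.≤∧≢⇒< (Q-nonneg a) 0≢Q)
  where
  3≰0 : ¬ (+ 3 ≤ + 0)
  3≰0 (+≤+ ())
  B²+3≡0 : Q a ≡ + 0 → + 3 + B a b * B a b ≡ + 0
  B²+3≡0 Q≡0 = begin
    + 3 + B a b * B a b                        ≡⟨ ℤP.+-comm (+ 3) (B a b * B a b) ⟩
    B a b * B a b + + 3                        ≡⟨ cong (λ d² → B a b * B a b + + 3 * d²) (sym (unimodular-det² u)) ⟩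
    B a b * B a b + + 3 * (det a b * det a b)  ≡⟨ sym (key-identity a b) ⟩
    + 4 * (Q a * Q b)                          ≡⟨ cong (λ q → + 4 * (q * Q b)) Q≡0 ⟩
    + 0                                        ∎
    where open ≡-Reasoning
  0≢Q : + 0 ≢ Q a
  0≢Q 0≡Q = 3≰0 (≤-by (B a b * B a b) (sym (B²+3≡0 (sym 0≡Q))) (0≤² (B a b)))

-- Parents in the Farey tree

-- a ⊕ b is the apex born on the Farey edge {a, b}: by Q-⊕ and Q-⊖ it is the apex with the larger Q.
-- The orientation decides which endpoint of the edge is a.
record Parents (a b : V) : Set where
  field
    orientation : det b a ≡ + 1
    0<B         : + 0 < B a b

module _ {a b : V} (p : Parents a b) where
  open Parents p

  parents-unimodular : Unimodular a b
  parents-unimodular = unimodular-sym (det≡1⇒unimodular orientation)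

  private
    rearrange : ∀ x y z → x + y + z ≡ y + (x + z)
    rearrange = solve-∀

  Q[a]<Q[a⊕b] : Q a < Q (a ⊕ b)
  Q[a]<Q[a⊕b] = <-by (Q b + B a b) (trans (Q-⊕ a b) (ℤP.+-assoc (Q a) (Q b) (B a b))) (ℤP.+-mono-≤-< (Q-nonneg b) 0<B)

  Q[b]<Q[a⊕b] : Q b < Q (a ⊕ b)
  Q[b]<Q[a⊕b] = <-by (Q a + B a b) (trans (Q-⊕ a b) (rearrange (Q a) (Q b) (B a b))) (ℤP.+-mono-≤-< (Q-nonneg a) 0<B)

  Q[a⊖b]<Q[a⊕b] : Q (a ⊖ b) < Q (a ⊕ b)
  Q[a⊖b]<Q[a⊕b] = <-by (B a b + B a b) Q[a⊕b]≡Q[a⊖b]+2B (ℤP.+-mono-< 0<B 0<B)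
    where
    shift : ∀ x y → x + y ≡ x - y + (y + y)
    shift = solve-∀
    Q[a⊕b]≡Q[a⊖b]+2B : Q (a ⊕ b) ≡ Q (a ⊖ b) + (B a b + B a b)
    Q[a⊕b]≡Q[a⊖b]+2B = begin
      Q (a ⊕ b)                              ≡⟨ Q-⊕ a b ⟩
      Q a + Q b + B a b                      ≡⟨ shift (Q a + Q b) (B a b) ⟩
      Q a + Q b - B a b + (B a b + B a b)    ≡⟨ cong (_+ (B a b + B a b)) (sym (Q-⊖ a b)) ⟩
      Q (a ⊖ b) + (B a b + B a b)            ∎
      where open ≡-Reasoning

  3≤Q[a⊕b] : + 3 ≤ Q (a ⊕ b)
  3≤Q[a⊕b] = subst (+ 3 ≤_) (sym (Q-⊕ a b)) (ℤP.+-mono-≤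
    (ℤP.+-mono-≤ (Q≥1 parents-unimodular) (Q≥1 (unimodular-sym parents-unimodular))) (ℤP.i<j⇒suc[i]≤j 0<B))

-- The parent a of v is the unique unimodular partner of v in this window.
record Reduced (v a : V) : Set where
  field
    det≡1 : det v a ≡ + 1
    0<B   : + 0 < B a v
    B<2Q  : B a v < + 2 * Q v

parents⇒reduced : ∀ {a b} → Parents a b → Reduced (a ⊕ b) a
parents⇒reduced {a} {b} p = record
  { det≡1 = trans (det-⊕ˡ-self a b) orientation
  ; 0<B   = subst (+ 0 <_) (sym (B-⊕ʳ-self a b)) (ℤP.+-mono-≤-< (0≤2Q a) 0<B)
  ; B<2Q  = <-by (B b (a ⊕ b)) 2Q≡B+B (subst (+ 0 <_) (sym B[b,a⊕b]) (ℤP.+-mono-≤-< (0≤2Q b) 0<B))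
  }
  where
  open Parents p
  0≤2Q : ∀ x → + 0 ≤ + 2 * Q x
  0≤2Q x = 0≤* {+ 2} (+≤+ ℕ.z≤n) (Q-nonneg x)
  B[b,a⊕b] : B b (a ⊕ b) ≡ + 2 * Q b + B a b
  B[b,a⊕b] = begin
    B b (a ⊕ b)           ≡⟨ cong (B b) (⊕-comm a b) ⟩
    B b (b ⊕ a)           ≡⟨ B-⊕ʳ-self b a ⟩
    + 2 * Q b + B b a     ≡⟨ cong (_+_ (+ 2 * Q b)) (B-comm b a) ⟩
    + 2 * Q b + B a b     ∎
    where open ≡-Reasoning
  2Q≡B+B : + 2 * Q (a ⊕ b) ≡ B a (a ⊕ b) + B b (a ⊕ b)
  2Q≡B+B = begin
    + 2 * Q (a ⊕ b)                          ≡⟨ sym (B-self (a ⊕ b)) ⟩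
    B (a ⊕ b) (a ⊕ b)                        ≡⟨ B-⊕ˡ a b (a ⊕ b) ⟩
    B a (a ⊕ b) + B b (a ⊕ b)                ∎
    where open ≡-Reasoning

reduced-unique : ∀ {v a a′} → Reduced v a → Reduced v a′ → a ≡ a′
reduced-unique {v} {a} {a′} r r′ = begin
  a                  ≡⟨ cong₂ _,_ (sym (ℤP.+-identityʳ _)) (sym (ℤP.+-identityʳ _)) ⟩
  a ⊕ + 0 • v        ≡⟨ cong (λ k → a ⊕ k • v) (sym k≡0) ⟩
  a ⊕ k • v          ≡⟨ cong (a ⊕_) (sym a′⊖a≡k•v) ⟩
  a ⊕ (a′ ⊖ a)       ≡⟨ ⊕-⊖-cancel a a′ ⟩
  a′                 ∎
  where
  open ≡-Reasoning
  open Reduced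
  k : ℤ
  k = det (a′ ⊖ a) a
  a′⊖a≡k•v : a′ ⊖ a ≡ k • v
  a′⊖a≡k•v = parallel v a (a′ ⊖ a) (det≡1 r) (begin
    det v (a′ ⊖ a)        ≡⟨ det-⊖ʳ v a′ a ⟩
    det v a′ - det v a    ≡⟨ cong₂ _-_ (det≡1 r′) (det≡1 r) ⟩
    + 0                   ∎)
  B-B≡k*2Q : B a′ v - B a v ≡ k * (+ 2 * Q v)
  B-B≡k*2Q = begin
    B a′ v - B a v        ≡⟨ sym (B-⊖ˡ a′ a v) ⟩
    B (a′ ⊖ a) v          ≡⟨ cong (λ x → B x v) a′⊖a≡k•v ⟩
    B (k • v) v           ≡⟨ B-•ˡ-self k v ⟩
    k * (+ 2 * Q v)       ∎
  k≡0 : k ≡ + 0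
  k≡0 = -n<k*n<n⇒k≡0 (ℤP.<-trans (0<B r) (B<2Q r))
    (subst (- (+ 2 * Q v) <_) B-B≡k*2Q (proj₁ window)) (subst (_< + 2 * Q v) B-B≡k*2Q (proj₂ window))
    where
    window : - (+ 2 * Q v) < B a′ v - B a v × B a′ v - B a v < + 2 * Q v
    window = -n<y-x<n (0<B r) (B<2Q r) (0<B r′) (B<2Q r′)

parents-unique : ∀ {a b a′ b′} → Parents a b → Parents a′ b′ → a ⊕ b ≡ a′ ⊕ b′ → a ≡ a′ × b ≡ b′
parents-unique {a} {b} {a′} {b′} p p′ eq = a≡a′ , b≡b′
  where
  a≡a′ : a ≡ a′
  a≡a′ = reduced-unique (parents⇒reduced p) (subst (λ v → Reduced v a′) (sym eq) (parents⇒reduced p′))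
  b≡b′ : b ≡ b′
  b≡b′ = begin
    b                    ≡⟨ sym (⊕-⊖-cancel′ a b) ⟩
    (a ⊕ b) ⊖ a          ≡⟨ cong₂ _⊖_ eq a≡a′ ⟩
    (a′ ⊕ b′) ⊖ a′       ≡⟨ ⊕-⊖-cancel′ a′ b′ ⟩
    b′                   ∎
    where open ≡-Reasoning

oriented-partner : ∀ {v w} → Unimodular v w → Σ V (λ w′ → det v w′ ≡ + 1)
oriented-partner {v} {w} (unimodular u) with ∣i∣≡1⇒i≡±1 {det v w} u
... | inj₁ det≡1  = w , det≡1
... | inj₂ det≡-1 = ⊝ w , trans (det-⊝ʳ v w) (cong -_ det≡-1)

reduced-exists : ∀ {v w} → Unimodular v w → Σ V (Reduced v)
reduced-exists {v} {w} u with oriented-partner u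
... | w′ , det[v,w′]≡1 = a , record
  { det≡1 = det[v,a]≡1
  ; 0<B   = ℤP.≤∧≢⇒< 0≤B (λ 0≡B → B≢0 {a} {v} (unimodular-sym (det≡1⇒unimodular det[v,a]≡1)) (sym 0≡B))
  ; B<2Q  = subst₂ _<_ (sym B≡r) (ℤP.0≤i⇒+∣i∣≡i (ℤP.<⇒≤ 0<n)) (+<+ (n%d<d (B w′ v) n))
  }
  where
  n : ℤ
  n = + 2 * Q v
  0<n : + 0 < n
  0<n = ℤP.<-≤-trans (+<+ (ℕ.s≤s ℕ.z≤n)) (ℤP.*-monoˡ-≤-nonNeg (+ 2) (Q≥1 u))
  instance
    n-nonZero : ℤ.NonZero n
    n-nonZero = ℤ.>-nonZero 0<n
  m : ℤ
  m = B w′ v ℤ./ n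
  r : ℕ
  r = B w′ v ℤ.% n
  a : V
  a = w′ ⊖ m • v
  det[v,a]≡1 : det v a ≡ + 1
  det[v,a]≡1 = begin
    det v (w′ ⊖ m • v)          ≡⟨ det-⊖ʳ v w′ (m • v) ⟩
    det v w′ - det v (m • v)    ≡⟨ cong₂ _-_ det[v,w′]≡1 (det-•ʳ-self v m) ⟩
    + 1                         ∎
    where open ≡-Reasoning
  B≡r : B a v ≡ + r
  B≡r = begin
    B (w′ ⊖ m • v) v            ≡⟨ B-⊖ˡ w′ (m • v) v ⟩
    B w′ v - B (m • v) v        ≡⟨ cong₂ _-_ (a≡a%n+[a/n]*n (B w′ v) n) (B-•ˡ-self m v) ⟩
    + r + m * n - m * n         ≡⟨ cancel (+ r) (m * n) ⟩
    + r                         ∎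
    where
    open ≡-Reasoning
    cancel : ∀ x y → x + y - y ≡ x
    cancel = solve-∀
  0≤B : + 0 ≤ B a v
  0≤B = subst (+ 0 ≤_) (sym B≡r) (+≤+ ℕ.z≤n)

reduced⇒parents : ∀ {v a} → + 2 ≤ Q v → Reduced v a → Parents a (v ⊖ a)
reduced⇒parents {v} {a} 2≤Q r = record
  { orientation = orientation
  ; 0<B = 0<2pq+3⇒0<p 0<2pq+3 2≤Q (B≢0 {a} {v ⊖ a} (unimodular-sym (det≡1⇒unimodular orientation)))
  }
  where
  open Reduced r
  orientation : det (v ⊖ a) a ≡ + 1
  orientation = trans (det-⊖ˡ-self v a) det≡1
  0<2pq+3 : + 0 < + 2 * (B a (v ⊖ a) * Q v) + + 3
  0<2pq+3 = subst (+ 0 <_) product≡ (0<* 0<B (subst (+ 0 <_) (sym (B-⊖ˡ-self v a)) (i<j⇒0<j-i B<2Q)))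
    where
    product≡ : B a v * B (v ⊖ a) v ≡ + 2 * (B a (v ⊖ a) * Q v) + + 3
    product≡ = trans (B-product v a) (cong (λ d → + 2 * (B a (v ⊖ a) * Q v) + + 3 * (d * d)) det≡1)

parents-exist : ∀ {v w} → Unimodular v w → + 2 ≤ Q v → Σ V (λ a → Parents a (v ⊖ a))
parents-exist u 2≤Q = map₂ (reduced⇒parents 2≤Q) (reduced-exists u)

parents-⊝ : ∀ {a b} → Parents a b → Parents (⊝ a) (⊝ b)
parents-⊝ {a} {b} p = record
  { orientation = trans (det-⊝ b a) (Parents.orientation p)
  ; 0<B         = subst (+ 0 <_) (sym (B-⊝ a b)) (Parents.0<B p)
  }

unimodular⇒parents : ∀ {a b} → Unimodular a b → + 0 < B a b → Parents a b ⊎ Parents b a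
unimodular⇒parents {a} {b} (unimodular u) 0<B with ∣i∣≡1⇒i≡±1 {det a b} u
... | inj₁ det[a,b]≡1  = inj₂ (record { orientation = det[a,b]≡1 ; 0<B = subst (+ 0 <_) (B-comm a b) 0<B })
... | inj₂ det[a,b]≡-1 = inj₁ (record { orientation = trans (det-antisym b a) (cong -_ det[a,b]≡-1) ; 0<B = 0<B })

-- Markov values

data Point₂ : Set where
  0₂ ∞₂ 1₂ : Point₂

-- The image (q mod 2 : p mod 2) of q/p in P¹𝔽₂; (even , even) does not occur for primitive vectors.
point₂ : Bool → Bool → Point₂
point₂ false _     = 0₂
point₂ true  false = ∞₂
point₂ true  true  = 1₂

reduce₂ : V → Point₂
reduce₂ (q , p) = point₂ (isOdd q) (isOdd p)

reduce₂-⊝ : ∀ v → reduce₂ (⊝ v) ≡ reduce₂ v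
reduce₂-⊝ (q , p) = cong₂ point₂ (isOdd-neg q) (isOdd-neg p)

reduce₂-⊖ : ∀ a b → reduce₂ (a ⊖ b) ≡ reduce₂ (a ⊕ b)
reduce₂-⊖ (a₁ , a₂) (b₁ , b₂) =
  cong₂ point₂ (isOdd-+2* (a₁ + b₁) (- b₁) (identity a₁ b₁)) (isOdd-+2* (a₂ + b₂) (- b₂) (identity a₂ b₂))
  where
  identity : ∀ a b → a - b ≡ a + b + + 2 * (- b)
  identity = solve-∀

monomialTerm : Point₂ → Term
monomialTerm 0₂ = term (+ 1) (+ 1) (+ 0) (+ 0)
monomialTerm ∞₂ = term (+ 1) (+ 0) (+ 1) (+ 0)
monomialTerm 1₂ = term (+ 1) (+ 0) (+ 0) (+ 1)

monomial : Point₂ → LP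
monomial κ = monomialTerm κ ∷ []

-- MarkovValue v L says that f at the point ±v is L; step is the recursion on the edge where a ⊕ b is born.
data MarkovValue : V → LP → Set where
  base : ∀ {v} → Q v ≡ + 1 → MarkovValue v (monomial (reduce₂ v))
  step : ∀ {a b La Lb Lc} → Parents a b →
         MarkovValue a La → MarkovValue b Lb → MarkovValue (a ⊖ b) Lc →
         MarkovValue (a ⊕ b) (exchange La Lb Lc)

markovValue-unique : ∀ {v v′ L L′} → MarkovValue v L → MarkovValue v′ L′ → v ≡ v′ → L ≋ L′
markovValue-unique (base _)       (base _)        refl = ≋-refl
markovValue-unique (base Q≡1)     (step p _ _ _)  refl = contradiction (subst (+ 3 ≤_) Q≡1 (3≤Q[a⊕b] p)) 3≰1
markovValue-unique (step p _ _ _) (base Q≡1)      refl = contradiction (subst (+ 3 ≤_) Q≡1 (3≤Q[a⊕b] p)) 3≰1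
markovValue-unique (step {a} {b} p ma mb mc) (step {a′} {b′} p′ ma′ mb′ mc′) eq =
  exchange-cong (markovValue-unique ma ma′ a≡a′) (markovValue-unique mb mb′ b≡b′)
                (markovValue-unique mc mc′ (cong₂ _⊖_ a≡a′ b≡b′))
  where
  a≡a′ : a ≡ a′
  a≡a′ = proj₁ (parents-unique p p′ eq)
  b≡b′ : b ≡ b′
  b≡b′ = proj₂ (parents-unique p p′ eq)

markovValue-⊝ : ∀ {v L} → MarkovValue v L → MarkovValue (⊝ v) L
markovValue-⊝ {v} (base Q≡1) =
  subst (MarkovValue (⊝ v)) (cong monomial (reduce₂-⊝ v)) (base (trans (Q-⊝ v) Q≡1))
markovValue-⊝ (step {a} {b} p ma mb mc) =
  subst (λ x → MarkovValue x _) (⊝-⊕ a b)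
    (step (parents-⊝ p) (markovValue-⊝ ma) (markovValue-⊝ mb)
          (subst (λ x → MarkovValue x _) (sym (⊝-⊖ a b)) (markovValue-⊝ mc)))

markovValue-exists : ∀ {v w} → Unimodular v w → Σ LP (MarkovValue v)
markovValue-exists {v} u = descend ∣ Q v ∣ u (ℤP.≤-reflexive (sym (ℤP.0≤i⇒+∣i∣≡i (Q-nonneg v))))
  where
  1≰0 : ¬ (+ 1 ≤ + 0)
  1≰0 (ℤ.+≤+ ())
  descend : ∀ n {v w} → Unimodular v w → Q v ≤ + n → Σ LP (MarkovValue v)
  descend zero    u Q≤0   = contradiction (ℤP.≤-trans (Q≥1 u) Q≤0) 1≰0
  descend (suc n) {v} u Q≤1+n = split (Q v ℤ.≤? + 1)
    where
    from-parents : ∀ {a} → Parents a (v ⊖ a) → Σ LP (MarkovValue v)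
    from-parents {a} p = combine (descend n u-ab (below a (Q[a]<Q[a⊕b] p)))
                                 (descend n (unimodular-sym u-ab) (below b (Q[b]<Q[a⊕b] p)))
                                 (descend n a⊖b~a (below (a ⊖ b) (Q[a⊖b]<Q[a⊕b] p)))
      where
      b : V
      b = v ⊖ a
      u-ab : Unimodular a b
      u-ab = parents-unimodular p
      a⊖b~a : Unimodular (a ⊖ b) a
      a⊖b~a = unimodular-sym (proj₁ (proj₂ (proj₂ (unimodular-triangle u-ab))))
      below : ∀ x → Q x < Q (a ⊕ b) → Q x ≤ + n
      below x Q<Q = ℤP.i<j⇒i≤pred[j] (ℤP.<-≤-trans Q<Q (subst (_≤ + suc n) (cong Q (sym (⊕-⊖-cancel a v))) Q≤1+n))
      combine : Σ LP (MarkovValue a) → Σ LP (MarkovValue b) → Σ LP (MarkovValue (a ⊖ b)) → Σ LP (MarkovValue v)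
      combine (La , ma) (Lb , mb) (Lc , mc) =
        exchange La Lb Lc , subst (λ x → MarkovValue x (exchange La Lb Lc)) (⊕-⊖-cancel a v) (step p ma mb mc)
    split : Dec (Q v ≤ + 1) → Σ LP (MarkovValue v)
    split (yes Q≤1) = monomial (reduce₂ v) , base (ℤP.≤-antisym Q≤1 (Q≥1 u))
    split (no  Q≰1) = from-parents (proj₂ (parents-exist u (ℤP.i<j⇒suc[i]≤j (ℤP.≰⇒> Q≰1))))

exchange-relation⁺ : ∀ {a b La Lb Lp Lm} → Unimodular a b → + 0 < B a b →
  MarkovValue a La → MarkovValue b Lb → MarkovValue (a ⊕ b) Lp → MarkovValue (a ⊖ b) Lm → Lp ≋ exchange La Lb Lm
exchange-relation⁺ {a} {b} {La} {Lb} {Lp} {Lm} u 0<B ma mb mp mm = oriented (unimodular⇒parents u 0<B)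
  where
  oriented : Parents a b ⊎ Parents b a → Lp ≋ exchange La Lb Lm
  oriented (inj₁ p) = markovValue-unique mp (step p ma mb mm) refl
  oriented (inj₂ p) = ≋-trans (markovValue-unique mp (step p mb ma mm′) (⊕-comm a b)) (exchange-comm Lb La Lm)
    where
    mm′ : MarkovValue (b ⊖ a) Lm
    mm′ = subst (λ x → MarkovValue x Lm) (sym (⊖-anticomm a b)) (markovValue-⊝ mm)

-- The apex born on the edge {a, b} is a ⊕ b or a ⊖ b according to the sign of B a b.
exchange-relation : ∀ {a b La Lb Lp Lm} → Unimodular a b →
  MarkovValue a La → MarkovValue b Lb → MarkovValue (a ⊕ b) Lp → MarkovValue (a ⊖ b) Lm → Lp ≋ exchange La Lb Lm
exchange-relation {a} {b} {La} {Lb} {Lp} {Lm} u ma mb mp mm = by-sign (ℤP.<-cmp (+ 0) (B a b))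
  where
  by-sign : Tri (+ 0 < B a b) (+ 0 ≡ B a b) (B a b < + 0) → Lp ≋ exchange La Lb Lm
  by-sign (tri< 0<B _ _) = exchange-relation⁺ u 0<B ma mb mp mm
  by-sign (tri≈ _ 0≡B _) = contradiction (sym 0≡B) (B≢0 u)
  by-sign (tri> _ _ B<0) = exchange-flip {La} {Lb}
    (exchange-relation⁺ (unimodular-⊝ʳ u) 0<B[a,⊝b] ma (markovValue-⊝ mb) mm
                        (subst (λ x → MarkovValue x Lp) (sym (⊖-⊝ a b)) mp))
    where
    0<B[a,⊝b] : + 0 < B a (⊝ b)
    0<B[a,⊝b] = subst (+ 0 <_) (sym (B-⊝ʳ a b)) (ℤP.neg-mono-< B<0)

-- Exponents

Bool³ : Set
Bool³ = Bool × Bool × Bool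

infixl 6 _⊻_
_⊻_ : Bool³ → Bool³ → Bool³
(x , y , z) ⊻ (x′ , y′ , z′) = x xor x′ , y xor y′ , z xor z′

degree : Term → ℤ
degree (term _ x y z) = x + y + z

oddness : Term → Bool³
oddness (term _ x y z) = isOdd x , isOdd y , isOdd z

record OfType (d : ℤ) (o : Bool³) (t : Term) : Set where
  constructor ofType
  field
    degree≡  : degree t ≡ d
    oddness≡ : oddness t ≡ o

OfType-mulT : ∀ {d d′ o o′ t u} → OfType d o t → OfType d′ o′ u → OfType (d + d′) (o ⊻ o′) (mulT t u)
OfType-mulT {t = term _ x y z} {u = term _ x′ y′ z′} (ofType refl refl) (ofType refl refl) =
  ofType (rearrange x y z x′ y′ z′) $ cong₂ _,_ (isOdd-+ x x′) (cong₂ _,_ (isOdd-+ y y′) (isOdd-+ z z′))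
  where
  rearrange : ∀ x y z x′ y′ z′ → x + x′ + (y + y′) + (z + z′) ≡ x + y + z + (x′ + y′ + z′)
  rearrange = solve-∀

All-*L : ∀ {P R S : Term → Set} {p q} → All P p → All R q → (∀ {t u} → P t → R u → S (mulT t u)) → All S (p *L q)
All-*L []         Rq PR⇒S = []
All-*L (Pt ∷ Pp) Rq PR⇒S = AllP.++⁺ (AllP.map⁺ (All.map (PR⇒S Pt) Rq)) (All-*L Pp Rq PR⇒S)

All--L : ∀ {P : Term → Set} {p q} → All P p → All P q → (∀ {t} → P t → P (negT t)) → All P (p -L q)
All--L Pp Pq P⇒P∘negT = AllP.++⁺ Pp (AllP.map⁺ (All.map P⇒P∘negT Pq))

monomialParity : Point₂ → Bool³
monomialParity κ = oddness (monomialTerm κ)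

OfClass : Point₂ → Term → Set
OfClass κ = OfType (+ 1) (monomialParity κ)

monomial-ofClass : ∀ κ → All (OfClass κ) (monomial κ)
monomial-ofClass 0₂ = ofType refl refl ∷ []
monomial-ofClass ∞₂ = ofType refl refl ∷ []
monomial-ofClass 1₂ = ofType refl refl ∷ []

K-ofType : All (OfType -[1+ 0 ] (true , true , true)) K
K-ofType = ofType refl refl ∷ ofType refl refl ∷ ofType refl refl ∷ []

-- (p , q) and (r , s) are the parities of a and b, and the hypothesis says that det b a is odd.
monomialParity-exchange : ∀ p q r s → (r ∧ q) xor (s ∧ p) ≡ true →
  monomialParity (point₂ p q) ⊻ monomialParity (point₂ r s) ⊻ (true , true , true) ≡
  monomialParity (point₂ (p xor r) (q xor s))
monomialParity-exchange false false false false ()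
monomialParity-exchange false false false true  ()
monomialParity-exchange false false true  false ()
monomialParity-exchange false false true  true  ()
monomialParity-exchange false true  false false ()
monomialParity-exchange false true  false true  ()
monomialParity-exchange false true  true  false _ = refl
monomialParity-exchange false true  true  true  _ = refl
monomialParity-exchange true  false false false ()
monomialParity-exchange true  false false true  _ = refl
monomialParity-exchange true  false true  false ()
monomialParity-exchange true  false true  true  _ = refl
monomialParity-exchange true  true  false false ()
monomialParity-exchange true  true  false true  _ = refl
monomialParity-exchange true  true  true  false _ = refl
monomialParity-exchange true  true  true  true  ()

monomialParity-⊕ : ∀ {a b} → Unimodular a b →
  monomialParity (reduce₂ a) ⊻ monomialParity (reduce₂ b) ⊻ (true , true , true) ≡ monomialParity (reduce₂ (a ⊕ b))
monomialParity-⊕ {a₁ , a₂} {b₁ , b₂} u =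
  trans (monomialParity-exchange (isOdd a₁) (isOdd a₂) (isOdd b₁) (isOdd b₂) det[b,a]-odd)
        (cong monomialParity (sym (cong₂ point₂ (isOdd-+ a₁ b₁) (isOdd-+ a₂ b₂))))
  where
  det[b,a]-odd : (isOdd b₁ ∧ isOdd a₂) xor (isOdd b₂ ∧ isOdd a₁) ≡ true
  det[b,a]-odd = begin
    (isOdd b₁ ∧ isOdd a₂) xor (isOdd b₂ ∧ isOdd a₁)   ≡⟨ sym (cong₂ _xor_ (isOdd-* b₁ a₂) (isOdd-* b₂ a₁)) ⟩
    isOdd (b₁ * a₂) xor isOdd (b₂ * a₁)                ≡⟨ sym (isOdd-- (b₁ * a₂) (b₂ * a₁)) ⟩
    isOdd (det (b₁ , b₂) (a₁ , a₂))                   ≡⟨ unimodular-isOdd (unimodular-sym u) ⟩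
    true                                              ∎
    where open ≡-Reasoning

markovValue-ofClass : ∀ {v L} → MarkovValue v L → All (OfClass (reduce₂ v)) L
markovValue-ofClass {v} (base _) = monomial-ofClass (reduce₂ v)
markovValue-ofClass (step {a} {b} {La} {Lb} p ma mb mc) =
  All--L La*Lb*K (subst (λ κ → All (OfClass κ) _) (reduce₂-⊖ a b) (markovValue-ofClass mc))
         (λ (ofType d o) → ofType d o)
  where
  La*Lb : All (OfType (+ 2) (monomialParity (reduce₂ a) ⊻ monomialParity (reduce₂ b))) (La *L Lb)
  La*Lb = All-*L (markovValue-ofClass ma) (markovValue-ofClass mb) OfType-mulT
  La*Lb*K : All (OfClass (reduce₂ (a ⊕ b))) (La *L Lb *L K)
  La*Lb*K = All-*L La*Lb K-ofType λ {t} {k} Pt Pk →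
    subst (λ o → OfType (+ 1) o (mulT t k)) (monomialParity-⊕ (parents-unimodular p)) (OfType-mulT Pt Pk)

term-cong : ∀ {c c′ x x′ y y′ z z′} → c ≡ c′ → x ≡ x′ → y ≡ y′ → z ≡ z′ → term c x y z ≡ term c′ x′ y′ z′
term-cong refl refl refl refl = refl

toF : Term → ℤ × ℤ × ℤ
toF (term c x y z) = c , x - + 1 , y - + 1

sumF-map-toF : ∀ {o} L → All (OfType (+ 1) o) L → sumF (map toF L) ≡ L
sumF-map-toF []                 []                        = refl
sumF-map-toF (term c x y z ∷ L) (ofType x+y+z≡1 _ ∷ Ps) =
  cong₂ _∷_ (term-cong refl (shift x) (shift y) exponent-z) (sumF-map-toF L Ps)
  where
  shift : ∀ x → + 1 + (x - + 1) ≡ x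
  shift = solve-∀
  rearrange : ∀ x y z → - (+ 1 + (x - + 1) + (y - + 1)) ≡ + 1 - (x + y + z) + z
  rearrange = solve-∀
  exponent-z : - (+ 1 + (x - + 1) + (y - + 1)) ≡ z
  exponent-z = trans (rearrange x y z) (trans (cong (λ d → + 1 - d + z) x+y+z≡1) (ℤP.+-identityˡ z))

-- Division by a monomial m; the coefficient of m is ignored.
divideBy : Term → Term → Term
divideBy (term _ p q r) = mulT (term (+ 1) (- p) (- q) (- r))

isOdd≡false⇒2∣ : ∀ {n} → isOdd n ≡ false → + 2 ℤD.∣ n
isOdd≡false⇒2∣ {n} even = ℤDS.∣⇒∣ᵤ (ℤDS.divides (n /ℕ 2) (begin
  n                                 ≡⟨ isOdd-decomposition n ⟩
  bit (isOdd n) + + 2 * (n /ℕ 2)    ≡⟨ cong (λ r → bit r + + 2 * (n /ℕ 2)) even ⟩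
  + 0 + + 2 * (n /ℕ 2)              ≡⟨ ℤP.+-identityˡ _ ⟩
  + 2 * (n /ℕ 2)                    ≡⟨ ℤP.*-comm (+ 2) (n /ℕ 2) ⟩
  n /ℕ 2 * + 2                      ∎))
  where open ≡-Reasoning

2∣-p+x : ∀ p x → isOdd x ≡ isOdd p → + 2 ℤD.∣ (- p + x)
2∣-p+x p x same = isOdd≡false⇒2∣ { - p + x} (begin
  isOdd (- p + x)               ≡⟨ isOdd-+ (- p) x ⟩
  isOdd (- p) xor isOdd x       ≡⟨ cong₂ _xor_ (isOdd-neg p) same ⟩
  isOdd p xor isOdd p           ≡⟨ xor-same (isOdd p) ⟩
  false                         ∎)
  where open ≡-Reasoning

divideBy-even : ∀ m {t} → oddness t ≡ oddness m → EvenT (divideBy m t)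
divideBy-even (term _ p q r) {term _ x y z} same =
  2∣-p+x p x (cong proj₁ same) , 2∣-p+x q y (cong (proj₁ ∘ proj₂) same) , 2∣-p+x r z (cong (proj₂ ∘ proj₂) same)

mulT-divideBy : ∀ κ t → mulT (monomialTerm κ) (divideBy (monomialTerm κ) t) ≡ t
mulT-divideBy κ (term c x y z) = cancel κ
  where
  coef : + 1 * (+ 1 * c) ≡ c
  coef = trans (ℤP.*-identityˡ _) (ℤP.*-identityˡ c)
  exp : ∀ p x → p + (- p + x) ≡ x
  exp = solve-∀
  cancel : ∀ κ → mulT (monomialTerm κ) (divideBy (monomialTerm κ) (term c x y z)) ≡ term c x y z
  cancel 0₂ = term-cong coef (exp (+ 1) x) (exp (+ 0) y) (exp (+ 0) z)
  cancel ∞₂ = term-cong coef (exp (+ 0) x) (exp (+ 1) y) (exp (+ 0) z)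
  cancel 1₂ = term-cong coef (exp (+ 0) x) (exp (+ 0) y) (exp (+ 1) z)

monomial-*L-divideBy : ∀ κ L → monomial κ *L map (divideBy (monomialTerm κ)) L ≡ L
monomial-*L-divideBy κ L = begin
  map (mulT (monomialTerm κ)) (map (divideBy (monomialTerm κ)) L) ++ []  ≡⟨ ListP.++-identityʳ _ ⟩
  map (mulT (monomialTerm κ)) (map (divideBy (monomialTerm κ)) L)        ≡⟨ sym (ListP.map-∘ L) ⟩
  map (mulT (monomialTerm κ) ∘ divideBy (monomialTerm κ)) L              ≡⟨ ListP.map-cong (mulT-divideBy κ) L ⟩
  map id L                                                               ≡⟨ ListP.map-id L ⟩
  L                                                                      ∎
  where open ≡-Reasoning

-- Points of P¹ℚ

vec : P1Q → V
vec s = numer s , denom s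

infix 4 _≡±_
_≡±_ : V → V → Set
x ≡± y = x ≡ y ⊎ x ≡ ⊝ y

≡±-sym : ∀ {x y} → x ≡± y → y ≡± x
≡±-sym (inj₁ refl) = inj₁ refl
≡±-sym {y = y} (inj₂ refl) = inj₂ (sym (⊝-involutive y))

≡±-trans : ∀ {x y z} → x ≡± y → y ≡± z → x ≡± z
≡±-trans (inj₁ refl) y≡±z          = y≡±z
≡±-trans (inj₂ refl) (inj₁ refl)   = inj₂ refl
≡±-trans {z = z} (inj₂ refl) (inj₂ refl) = inj₁ (⊝-involutive z)

Q-≡± : ∀ {x y} → x ≡± y → Q x ≡ Q y
Q-≡± (inj₁ refl) = refl
Q-≡± {y = y} (inj₂ refl) = Q-⊝ y

reduce₂-≡± : ∀ {x y} → x ≡± y → reduce₂ x ≡ reduce₂ y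
reduce₂-≡± (inj₁ refl) = refl
reduce₂-≡± {y = y} (inj₂ refl) = reduce₂-⊝ y

unimodular-≡±ʳ : ∀ {x y y′} → y ≡± y′ → Unimodular x y′ → Unimodular x y
unimodular-≡±ʳ (inj₁ refl) u = u
unimodular-≡±ʳ (inj₂ refl) u = unimodular-⊝ʳ u

unimodular-≡± : ∀ {x x′ y y′} → x ≡± x′ → y ≡± y′ → Unimodular x′ y′ → Unimodular x y
unimodular-≡± x≡± y≡± u = unimodular-≡±ʳ y≡± (unimodular-sym (unimodular-≡±ʳ x≡± (unimodular-sym u)))

markovValue-≡± : ∀ {x y L} → x ≡± y → MarkovValue y L → MarkovValue x L
markovValue-≡± (inj₁ refl) m = m
markovValue-≡± (inj₂ refl) m = markovValue-⊝ m

vec-≡±-injective : ∀ {s t} → vec s ≡± vec t → s ≡ t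
vec-≡±-injective {∞}                {∞}                 _ = refl
vec-≡±-injective {∞}                {fin (mkℚ _ _ _)}   (inj₁ ())
vec-≡±-injective {∞}                {fin (mkℚ _ _ _)}   (inj₂ ())
vec-≡±-injective {fin (mkℚ _ _ _)}  {∞}                 (inj₁ ())
vec-≡±-injective {fin (mkℚ _ _ _)}  {∞}                 (inj₂ ())
vec-≡±-injective {fin (mkℚ _ _ _)}  {fin (mkℚ _ _ _)}   (inj₁ refl) = cong fin (ℚP.mkℚ-cong refl refl)
vec-≡±-injective {fin (mkℚ _ _ _)}  {fin (mkℚ _ _ _)}   (inj₂ ())

fareyNb⇒unimodular : ∀ {s t} → FareyNb s t → Unimodular (vec t) (vec s)
fareyNb⇒unimodular {s} {t} nb =
  unimodular (trans (cong (λ x → ∣ x - denom t * numer s ∣) (ℤP.*-comm (numer t) (denom s))) nb)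

unimodular⇒fareyNb : ∀ {s t} → Unimodular (vec t) (vec s) → FareyNb s t
unimodular⇒fareyNb {s} {t} (unimodular u) =
  trans (cong (λ x → ∣ x - denom t * numer s ∣) (ℤP.*-comm (denom s) (numer t))) u

≡±-fareyNb : ∀ {s t x y} → vec s ≡± x → vec t ≡± y → Unimodular y x → FareyNb s t
≡±-fareyNb es et u = unimodular⇒fareyNb (unimodular-≡± et es u)

unimodular⇒coprime : ∀ {q p y} → Unimodular (q , p) y → Coprime ∣ q ∣ ∣ p ∣
unimodular⇒coprime {q} {p} {y₁ , y₂} (unimodular u) {i} (i∣q , i∣p) = ∣1⇒≡1 (subst (i ∣ℕ_) u (ℤDS.∣⇒∣ᵤ i∣det))
  where
  i∣det : + i ℤDS.∣ q * y₂ - p * y₁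
  i∣det = ℤDS.∣m∣n⇒∣m-n (ℤDS.∣m⇒∣m*n y₂ (ℤDS.∣ᵤ⇒∣ {+ i} {q} i∣q)) (ℤDS.∣m⇒∣m*n y₁ (ℤDS.∣ᵤ⇒∣ {+ i} {p} i∣p))

point : ∀ {x y} → Unimodular x y → Σ P1Q (λ s → vec s ≡± x)
point {q , + zero}     {y₁ , y₂} (unimodular u) = ∞ , unit (∣i∣≡1⇒i≡±1 {q} ∣q∣≡1)
  where
  ∣q∣≡1 : ∣ q ∣ ≡ 1
  ∣q∣≡1 = ℕP.m*n≡1⇒m≡1 ∣ q ∣ ∣ y₂ ∣ (trans (sym (ℤP.abs-* q y₂)) (trans (cong ∣_∣ (sym (ℤP.+-identityʳ (q * y₂)))) u))
  unit : q ≡ + 1 ⊎ q ≡ -[1+ 0 ] → vec ∞ ≡± (q , + 0)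
  unit (inj₁ refl) = inj₁ refl
  unit (inj₂ refl) = inj₂ refl
point {q , +[1+ d ]} u = fin (mkℚ q d (unimodular⇒coprime u)) , inj₁ refl
point {q , -[1+ d ]} u =
  fin (mkℚ (- q) d (subst (λ n → Coprime n (suc d)) (sym (ℤP.∣-i∣≡∣i∣ q)) (unimodular⇒coprime u))) , inj₂ refl

pos-bezout : ∀ a b c d → 1 ℕ.+ a ℕ.* b ≡ c ℕ.* d → + c * + d ≡ + 1 + + a * + b
pos-bezout a b c d eq = trans (sym (ℤP.pos-* c d)) (trans (cong +_ (sym eq)) (cong (_+_ (+ 1)) (ℤP.pos-* a b)))

bezout-unimodular : ∀ {m k} → Bézout.Identity 1 m k → Σ V (Unimodular (+ m , + k))
bezout-unimodular {m} {k} (Bézout.+- x y eq) = (+ y , + x) , det≡1⇒unimodular (begin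
  + m * + x - + k * + y           ≡⟨ swap (+ m) (+ x) (+ k) (+ y) ⟩
  + x * + m - + y * + k           ≡⟨ cong (_- + y * + k) (pos-bezout y k x m eq) ⟩
  + 1 + + y * + k - + y * + k     ≡⟨ cancel (+ 1) (+ y * + k) ⟩
  + 1                             ∎)
  where
  open ≡-Reasoning
  swap : ∀ a b c d → a * b - c * d ≡ b * a - d * c
  swap = solve-∀
  cancel : ∀ a b → a + b - b ≡ a
  cancel = solve-∀
bezout-unimodular {m} {k} (Bézout.-+ x y eq) = (+ y , + x) , unimodular (cong ∣_∣ (begin
  + m * + x - + k * + y           ≡⟨ swap (+ m) (+ x) (+ k) (+ y) ⟩
  + x * + m - + y * + k           ≡⟨ cong (_-_ (+ x * + m)) (pos-bezout x m y k eq) ⟩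
  + x * + m - (+ 1 + + x * + m)   ≡⟨ cancel (+ x * + m) ⟩
  -[1+ 0 ]                        ∎))
  where
  open ≡-Reasoning
  swap : ∀ a b c d → a * b - c * d ≡ b * a - d * c
  swap = solve-∀
  cancel : ∀ a → a - (+ 1 + a) ≡ -[1+ 0 ]
  cancel = solve-∀

bezout : ∀ s → Σ V (Unimodular (vec s))
bezout ∞                            = (+ 0 , + 1) , unimodular refl
bezout (fin (mkℚ (+ m)    d coprime)) = bezout-unimodular (coprime-Bézout (recompute coprime))
bezout (fin (mkℚ -[1+ m ] d coprime)) with bezout-unimodular (coprime-Bézout (recompute coprime))
... | (w₁ , w₂) , unimodular u = (w₁ , - w₂) , unimodular (trans (cong ∣_∣ (identity (+ suc m) (+ suc d) w₁ w₂)) u)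
  where
  identity : ∀ q p w₁ w₂ → - q * - w₂ - p * w₁ ≡ q * w₂ - p * w₁
  identity = solve-∀

farey-apex : ∀ {x₀ x₁ y} → Unimodular x₀ x₁ → Unimodular y x₁ → Unimodular x₀ y →
             y ≡± x₀ ⊕ x₁ ⊎ y ≡± x₀ ⊖ x₁
farey-apex {x₀} {x₁} {y} (unimodular e) (unimodular α) (unimodular β) =
  Sum.map (≡±-trans y≡±αx₀+βx₁) (≡±-trans y≡±αx₀+βx₁)
    (combination (∣i∣≡1⇒i≡±1 {det y x₁} α) (∣i∣≡1⇒i≡±1 {det x₀ y} β))
  where
  ±1 : ℤ → Set
  ±1 d = d ≡ + 1 ⊎ d ≡ -[1+ 0 ]
  1• : ∀ x → + 1 • x ≡ x
  1• (x₁ , x₂) = cong₂ _,_ (ℤP.*-identityˡ x₁) (ℤP.*-identityˡ x₂)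
  -1• : ∀ x → -[1+ 0 ] • x ≡ ⊝ x
  -1• (x₁ , x₂) = cong₂ _,_ (ℤP.-1*i≡-i x₁) (ℤP.-1*i≡-i x₂)
  unit• : ∀ {d} x → ±1 d → x ≡± d • x
  unit• x (inj₁ refl) = inj₁ (sym (1• x))
  unit• x (inj₂ refl) = inj₂ (sym (trans (cong ⊝_ (-1• x)) (⊝-involutive x)))
  y≡±αx₀+βx₁ : y ≡± det y x₁ • x₀ ⊕ det x₀ y • x₁
  y≡±αx₀+βx₁ = ≡±-trans (unit• y (∣i∣≡1⇒i≡±1 {det x₀ x₁} e)) (inj₁ (cramer x₀ x₁ y))
  combination : ∀ {a b} → ±1 a → ±1 b → a • x₀ ⊕ b • x₁ ≡± x₀ ⊕ x₁ ⊎ a • x₀ ⊕ b • x₁ ≡± x₀ ⊖ x₁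
  combination (inj₁ refl) (inj₁ refl) = inj₁ (inj₁ (cong₂ _⊕_ (1• x₀) (1• x₁)))
  combination (inj₁ refl) (inj₂ refl) = inj₂ (inj₁ (cong₂ _⊕_ (1• x₀) (-1• x₁)))
  combination (inj₂ refl) (inj₁ refl) =
    inj₂ (inj₂ (trans (cong₂ _⊕_ (-1• x₀) (1• x₁)) (trans (⊕-comm (⊝ x₀) x₁) (⊖-anticomm x₀ x₁))))
  combination (inj₂ refl) (inj₂ refl) = inj₁ (inj₂ (trans (cong₂ _⊕_ (-1• x₀) (-1• x₁)) (⊝-⊕ x₀ x₁)))

farey-apexes : ∀ s₀ s₁ s s′ → FareyNb s₀ s₁ → FareyNb s₀ s → FareyNb s₁ s → FareyNb s₀ s′ → FareyNb s₁ s′ →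
               ¬ (s ≡ s′) →
               (vec s ≡± vec s₀ ⊕ vec s₁ × vec s′ ≡± vec s₀ ⊖ vec s₁) ⊎
               (vec s ≡± vec s₀ ⊖ vec s₁ × vec s′ ≡± vec s₀ ⊕ vec s₁)
farey-apexes s₀ s₁ s s′ nb₀₁ nb₀ nb₁ nb₀′ nb₁′ s≢s′ = pair (apex nb₀ nb₁) (apex nb₀′ nb₁′)
  where
  x₀ x₁ : V
  x₀ = vec s₀
  x₁ = vec s₁
  apex : ∀ {t} → FareyNb s₀ t → FareyNb s₁ t → vec t ≡± x₀ ⊕ x₁ ⊎ vec t ≡± x₀ ⊖ x₁
  apex {t} nb₀ nb₁ = farey-apex (unimodular-sym (fareyNb⇒unimodular {s₀} {s₁} nb₀₁))
                                (fareyNb⇒unimodular {s₁} {t} nb₁) (unimodular-sym (fareyNb⇒unimodular {s₀} {t} nb₀))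
  same : ∀ {y} → vec s ≡± y → vec s′ ≡± y → s ≡ s′
  same e e′ = vec-≡±-injective (≡±-trans e (≡±-sym e′))
  pair : vec s ≡± x₀ ⊕ x₁ ⊎ vec s ≡± x₀ ⊖ x₁ → vec s′ ≡± x₀ ⊕ x₁ ⊎ vec s′ ≡± x₀ ⊖ x₁ →
         (vec s ≡± x₀ ⊕ x₁ × vec s′ ≡± x₀ ⊖ x₁) ⊎ (vec s ≡± x₀ ⊖ x₁ × vec s′ ≡± x₀ ⊕ x₁)
  pair (inj₁ e) (inj₂ e′) = inj₁ (e , e′)
  pair (inj₂ e) (inj₁ e′) = inj₂ (e , e′)
  pair (inj₁ e) (inj₁ e′) = contradiction (same e e′) s≢s′
  pair (inj₂ e) (inj₂ e′) = contradiction (same e e′) s≢s′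

basePoint : Point₂ → P1Q
basePoint 0₂ = p0
basePoint ∞₂ = ∞
basePoint 1₂ = p-1

Q≡1⇒basePoint : ∀ s → Q (vec s) ≡ + 1 → s ≡ basePoint (reduce₂ (vec s))
Q≡1⇒basePoint ∞ _ = refl
Q≡1⇒basePoint (fin (mkℚ n zero c)) Q≡1 =
  numerator (Sum.map₂ n+1≡0⇒n≡-1 (ℤP.i*j≡0⇒i≡0∨j≡0 n n[n+1]≡0))
  where
  identity : ∀ n → n * n + n * + 1 + + 1 * + 1 - + 1 ≡ n * (n + + 1)
  identity = solve-∀
  n[n+1]≡0 : n * (n + + 1) ≡ + 0
  n[n+1]≡0 = trans (sym (identity n)) (cong (_- + 1) Q≡1)
  cancel : ∀ n → n + + 1 - + 1 ≡ n
  cancel = solve-∀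
  n+1≡0⇒n≡-1 : n + + 1 ≡ + 0 → n ≡ -[1+ 0 ]
  n+1≡0⇒n≡-1 n+1≡0 = trans (sym (cancel n)) (cong (_- + 1) n+1≡0)
  numerator : n ≡ + 0 ⊎ n ≡ -[1+ 0 ] → fin (mkℚ n zero c) ≡ basePoint (reduce₂ (n , + 1))
  numerator (inj₁ refl) = cong fin (ℚP.mkℚ-cong refl refl)
  numerator (inj₂ refl) = cong fin (ℚP.mkℚ-cong refl refl)
Q≡1⇒basePoint (fin (mkℚ n (suc e) c)) Q≡1 = contradiction 12≤4 λ { (+≤+ (ℕ.s≤s (ℕ.s≤s (ℕ.s≤s (ℕ.s≤s ()))))) }
  where
  identity : ∀ n e → + 4 * (n * n + n * (+ 2 + e) + (+ 2 + e) * (+ 2 + e)) ≡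
             + 12 + ((+ 2 * n + (+ 2 + e)) * (+ 2 * n + (+ 2 + e)) + + 3 * (e * e + + 4 * e))
  identity = solve-∀
  12≤4 : + 12 ≤ + 4
  12≤4 = ≤-by _ (trans (cong (+ 4 *_) (sym Q≡1)) (identity n (+ e))) (0≤+ (0≤² (+ 2 * n + (+ 2 + + e)))
           (0≤* {+ 3} (+≤+ ℕ.z≤n) (0≤+ (0≤² (+ e)) (0≤* {+ 4} {+ e} (+≤+ ℕ.z≤n) (+≤+ ℕ.z≤n)))))

isOdd≡∣x∣%2≡ᵇ1 : ∀ x → isOdd x ≡ (∣ x ∣ % 2 ℕ.≡ᵇ 1)
isOdd≡∣x∣%2≡ᵇ1 (+ n)    = refl
isOdd≡∣x∣%2≡ᵇ1 -[1+ n ] = sym (isOdd-neg -[1+ n ])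

bracket≡basePoint : ∀ s → bracket s ≡ basePoint (reduce₂ (vec s))
bracket≡basePoint s
  with ∣ numer s ∣ % 2 | m%n<n ∣ numer s ∣ 2 | isOdd≡∣x∣%2≡ᵇ1 (numer s)
     | ∣ denom s ∣ % 2 | m%n<n ∣ denom s ∣ 2 | isOdd≡∣x∣%2≡ᵇ1 (denom s)
... | 0 | _ | q-even | _ | _ | _      rewrite q-even = refl
... | 1 | _ | q-odd  | 0 | _ | p-even rewrite q-odd | p-even = refl
... | 1 | _ | q-odd  | 1 | _ | p-odd  rewrite q-odd | p-odd = refl
... | 1 | _ | _ | suc (suc _) | ℕ.s≤s (ℕ.s≤s ()) | _
... | suc (suc _) | ℕ.s≤s (ℕ.s≤s ()) | _ | _ | _ | _

-- The Markov family

markovValue-at : ∀ s → Σ LP (MarkovValue (vec s))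
markovValue-at s = markovValue-exists (proj₂ (bezout s))

markovFamily : P1Q → LP
markovFamily s = proj₁ (markovValue-at s)

markovFamily-value : ∀ s → MarkovValue (vec s) (markovFamily s)
markovFamily-value s = proj₂ (markovValue-at s)

markovFamily-isMarkov : IsMarkovFamily markovFamily
markovFamily-isMarkov =
  at-basePoint p0 refl , at-basePoint ∞ refl , at-basePoint p-1 refl , recursion
  where
  at-basePoint : ∀ s → Q (vec s) ≡ + 1 → markovFamily s ≈ monomial (reduce₂ (vec s))
  at-basePoint s Q≡1 = _≋_.coeff-≡ (markovValue-unique (markovFamily-value s) (base Q≡1) refl)
  recursion : ∀ s₀ s₁ s s′ → FareyNb s₀ s₁ → FareyNb s₀ s → FareyNb s₁ s → FareyNb s₀ s′ → FareyNb s₁ s′ →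
              ¬ (s ≡ s′) → markovFamily s ≈ exchange (markovFamily s₀) (markovFamily s₁) (markovFamily s′)
  recursion s₀ s₁ s s′ nb₀₁ nb₀ nb₁ nb₀′ nb₁′ s≢s′ =
    _≋_.coeff-≡ (by-apexes (farey-apexes s₀ s₁ s s′ nb₀₁ nb₀ nb₁ nb₀′ nb₁′ s≢s′))
    where
    u : Unimodular (vec s₀) (vec s₁)
    u = unimodular-sym (fareyNb⇒unimodular {s₀} {s₁} nb₀₁)
    mv : ∀ {t y} → vec t ≡± y → MarkovValue y (markovFamily t)
    mv {t} e = markovValue-≡± (≡±-sym e) (markovFamily-value t)
    by-apexes : (vec s ≡± vec s₀ ⊕ vec s₁ × vec s′ ≡± vec s₀ ⊖ vec s₁) ⊎
                (vec s ≡± vec s₀ ⊖ vec s₁ × vec s′ ≡± vec s₀ ⊕ vec s₁) →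
                markovFamily s ≋ exchange (markovFamily s₀) (markovFamily s₁) (markovFamily s′)
    by-apexes (inj₁ (e , e′)) = exchange-relation u (mv (inj₁ refl)) (mv (inj₁ refl)) (mv e) (mv e′)
    by-apexes (inj₂ (e , e′)) =
      exchange-relation (unimodular-⊝ʳ u) (mv (inj₁ refl)) (markovValue-⊝ (mv (inj₁ refl))) (mv e)
                        (subst (λ y → MarkovValue y (markovFamily s′)) (sym (⊖-⊝ (vec s₀) (vec s₁))) (mv e′))

module _ {h : P1Q → LP} (markov : IsMarkovFamily h) where

  private
    recursion : ∀ s₀ s₁ s s′ → FareyNb s₀ s₁ → FareyNb s₀ s → FareyNb s₁ s → FareyNb s₀ s′ → FareyNb s₁ s′ →
                ¬ (s ≡ s′) → h s ≈ exchange (h s₀) (h s₁) (h s′)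
    recursion = proj₂ (proj₂ (proj₂ markov))

  h-basePoint : ∀ κ → h (basePoint κ) ≋ monomial κ
  h-basePoint 0₂ = coeffwise (proj₁ markov)
  h-basePoint ∞₂ = coeffwise (proj₁ (proj₂ markov))
  h-basePoint 1₂ = coeffwise (proj₁ (proj₂ (proj₂ markov)))

  h≋markovValue : ∀ {v L} → MarkovValue v L → ∀ s → vec s ≡± v → h s ≋ L
  h≋markovValue {v} (base Q≡1) s e = begin
    h s                                   ≡⟨ cong h (Q≡1⇒basePoint s (trans (Q-≡± e) Q≡1)) ⟩
    h (basePoint (reduce₂ (vec s)))       ≈⟨ h-basePoint (reduce₂ (vec s)) ⟩
    monomial (reduce₂ (vec s))            ≡⟨ cong monomial (reduce₂-≡± e) ⟩
    monomial (reduce₂ v)                  ∎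
    where open import Relation.Binary.Reasoning.Setoid ≋-setoid
  h≋markovValue (step {a} {b} {La} {Lb} {Lc} p ma mb mc) s e =
    at-points (point u) (point (unimodular-sym u)) (point (unimodular-sym a~a⊖b))
    where
    u : Unimodular a b
    u = parents-unimodular p
    a~a⊕b : Unimodular a (a ⊕ b)
    a~a⊕b = proj₁ (unimodular-triangle u)
    b~a⊕b : Unimodular b (a ⊕ b)
    b~a⊕b = proj₁ (proj₂ (unimodular-triangle u))
    a~a⊖b : Unimodular a (a ⊖ b)
    a~a⊖b = proj₁ (proj₂ (proj₂ (unimodular-triangle u)))
    b~a⊖b : Unimodular b (a ⊖ b)
    b~a⊖b = proj₂ (proj₂ (proj₂ (unimodular-triangle u)))
    at-points : Σ P1Q (λ s₀ → vec s₀ ≡± a) → Σ P1Q (λ s₁ → vec s₁ ≡± b) → Σ P1Q (λ s′ → vec s′ ≡± a ⊖ b) →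
                h s ≋ exchange La Lb Lc
    at-points (s₀ , e₀) (s₁ , e₁) (s′ , e′) = ≋-trans
      (coeffwise (recursion s₀ s₁ s s′ (≡±-fareyNb e₀ e₁ (unimodular-sym u))
                            (≡±-fareyNb e₀ e (unimodular-sym a~a⊕b)) (≡±-fareyNb e₁ e (unimodular-sym b~a⊕b))
                            (≡±-fareyNb e₀ e′ (unimodular-sym a~a⊖b)) (≡±-fareyNb e₁ e′ (unimodular-sym b~a⊖b))
                            s≢s′))
      (exchange-cong (h≋markovValue ma s₀ e₀) (h≋markovValue mb s₁ e₁) (h≋markovValue mc s′ e′))
      where
      s≢s′ : ¬ (s ≡ s′)
      s≢s′ refl = ℤP.<-irrefl (trans (sym (Q-≡± e′)) (Q-≡± e)) (Q[a⊖b]<Q[a⊕b] p)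

  laurent-forms : ∀ s → (Σ FinSupp (λ F → h s ≈ sumF F)) ×
                        (Σ LP (λ g → InEvenSubring g × (h s ≈ h (bracket s) *L g)))
  laurent-forms s = (map toF L , _≋_.coeff-≡ (≋-trans h≋L (≡⇒≋ (sym (sumF-map-toF L ofClass))))) ,
                    (g , even , _≋_.coeff-≡ h≋h[bracket]*g)
    where
    L : LP
    L = markovFamily s
    κ : Point₂
    κ = reduce₂ (vec s)
    h≋L : h s ≋ L
    h≋L = h≋markovValue (markovFamily-value s) s (inj₁ refl)
    ofClass : All (OfClass κ) L
    ofClass = markovValue-ofClass (markovFamily-value s)
    g : LP
    g = map (divideBy (monomialTerm κ)) L
    even : InEvenSubring g
    even = AllP.map⁺ (All.map (λ {t} P → divideBy-even (monomialTerm κ) {t} (OfType.oddness≡ P)) ofClass)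
    h≋h[bracket]*g : h s ≋ h (bracket s) *L g
    h≋h[bracket]*g = begin
      h s                                ≈⟨ h≋L ⟩
      L                                  ≡⟨ sym (monomial-*L-divideBy κ L) ⟩
      monomial κ *L g                    ≈⟨ *L-cong (≋-sym (h-basePoint κ)) ≋-refl ⟩
      h (basePoint κ) *L g               ≡⟨ cong (λ t → h t *L g) (sym (bracket≡basePoint s)) ⟩
      h (bracket s) *L g                 ∎
      where open import Relation.Binary.Reasoning.Setoid ≋-setoid

proposition2p2 : (Σ (P1Q → LP) IsMarkovFamily) ×
    ((f : P1Q → LP) → IsMarkovFamily f → (s : P1Q) →
      (Σ FinSupp (λ F → f s ≈ sumF F)) ×
      (Σ LP (λ g → InEvenSubring g × (f s ≈ f (bracket s) *L g))))
proposition2p2 = (markovFamily , markovFamily-isMarkov) , λ h markov → laurent-forms {h} markov
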